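{- Let $\lambda,\mu$ be partitions of $n$ and suppose there is an integer $\ell\ge1$ such that $\lambda^\vee_s=\mu^\vee_s$ for all $1\le s\le\ell$. Then $A(\lambda,\mu)=A(\lambda[\ell],\mu[\ell])$.
   Context: $\nu^\vee$ denotes the dual (conjugate) partition, so $\nu^\vee_s$ is the length of the $s$-th column of the Young diagram of $\nu$. $\nu[\ell]$ is the partition obtained by deleting the leftmost $\ell$ columns of the Young diagram of $\nu$. For $m\ge 1$ (or $m=0$ with $\mathfrak{S}_0$ trivial), let $\Delta_m=\{\alpha_1,\dots,\alpha_{m-1}\}$; for $w\in\mathfrak{S}_m$, $\mathrm{Des}_L(w)=\{\alpha_j:w^{ -1}(j)>w^{ -1}(j+1)\}$, $\mathrm{Des}_R(w)=\{\alpha_j:w(j)>w(j+1)\}$; $\mathcal{D}(J,K)=\{w\in\mathfrak{S}_m:\mathrm{Des}_L(w)=\Delta_m\setminus J,\ \mathrm{Des}_R(w)\subseteq\Delta_m\setminus K\}$. For $\nu=(\nu_1,\dots,\nu_p)\vdash m$ with $p$ parts, $J_\nu=\Delta_m\setminus\{\alpha_{\nu_1},\dots,\alpha_{\nu_1+\cdots+\nu_{p-1}}\}$, $\mathbb{J}_\nu=\Delta_m\setminus J_{\nu^\vee}$, and for $\lambda',\mu'\vdash m$, $A(\lambda',\mu')=|\mathcal{D}(\mathbb{J}_{\lambda'},J_{\mu'})|$. -}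

module Defs where

open import Data.Nat using (ℕ; zero; suc; _+_; _∸_; _≤_; _<_; _<ᵇ_; _≡ᵇ_; _≤?_; _<?_)
open import Data.Bool using (Bool; true; false; not; _∧_; _∨_; if_then_else_)
open import Data.List using (List; []; _∷_; length; filter; map; concatMap; upTo; allFin)
open import Data.Vec using (Vec; []; _∷_; toList)
open import Data.Fin using (Fin; toℕ) renaming (_≟_ to _≟F_)
open import Data.Product using (_×_)
open import Data.List.Relation.Unary.All using (All)
open import Data.List.Relation.Unary.Linked using (Linked)
open import Relation.Binary.PropositionalEquality using (_≡_)
open import Relation.Nullary.Decidable using (T?)
open import Data.Nat.ListAction using (sum)
open import Data.Bool.ListAction using (and; any)
import Data.List.Relation.Unary.Unique.DecPropositional as UD

IsPartition : ℕ → List ℕ → Set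
IsPartition n ν = Linked (λ a b → b ≤ a) ν × All (λ a → 0 < a) ν × sum ν ≡ n

-- length of the s-th column (s ≥ 1) of the Young diagram: #{ i : ν_i ≥ s }
colLen : List ℕ → ℕ → ℕ
colLen ν s = length (filter (s ≤?_) ν)

head0 : List ℕ → ℕ
head0 []      = 0
head0 (a ∷ _) = a

dual : List ℕ → List ℕ
dual ν = map (λ i → colLen ν (suc i)) (upTo (head0 ν))

-- ν[ℓ]: delete the leftmost ℓ columns
dropCols : ℕ → List ℕ → List ℕ
dropCols ℓ ν = filter (0 <?_) (map (_∸ ℓ) ν)

-- Subsets of Δ_m = {α₁,…,α_{m-1}} are represented by their characteristic
-- function on the index j (only the values 1 ≤ j ≤ m-1 matter).

Subset : Set
Subset = ℕ → Bool

elemℕ : ℕ → List ℕ → Bool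
elemℕ x xs = any (λ y → x ≡ᵇ y) xs

partialSums : List ℕ → List ℕ
partialSums []          = []
partialSums (a ∷ [])    = []
partialSums (a ∷ b ∷ ν) = a ∷ map (a +_) (partialSums (b ∷ ν))

Jset : List ℕ → Subset
Jset ν j = not (elemℕ j (partialSums ν))

JJset : List ℕ → Subset
JJset ν j = not (Jset (dual ν) j)

-- Permutations of {1,…,m} in one-line notation: w is given by the vector
-- (w(1)-1, …, w(m)-1) of elements of Fin m, with no repetitions.

allVecs : (m k : ℕ) → List (Vec (Fin m) k)
allVecs m zero    = [] ∷ []
allVecs m (suc k) = concatMap (λ i → map (i ∷_) (allVecs m k)) (allFin m)

Sym : (m : ℕ) → List (Vec (Fin m) m)
Sym m = filter (λ w → UD.unique? _≟F_ (toList w)) (allVecs m m)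

oneLine : {m : ℕ} → Vec (Fin m) m → List ℕ
oneLine w = map (λ i → suc (toℕ i)) (toList w)

-- w(j) for 1 ≤ j ≤ m (0 otherwise)
evalAt : List ℕ → ℕ → ℕ
evalAt []       _             = 0
evalAt (x ∷ xs) zero          = 0
evalAt (x ∷ xs) (suc zero)    = x
evalAt (x ∷ xs) (suc (suc j)) = evalAt xs (suc j)

-- w⁻¹(v): the position (1-based) at which value v occurs (0 if absent)
posOf : List ℕ → ℕ → ℕ
posOf []       v = 0
posOf (x ∷ xs) v = if x ≡ᵇ v then 1 else (if posOf xs v ≡ᵇ 0 then 0 else suc (posOf xs v))

desL : {m : ℕ} → Vec (Fin m) m → Subset
desL w j = posOf (oneLine w) (suc j) <ᵇ posOf (oneLine w) j

desR : {m : ℕ} → Vec (Fin m) m → Subset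
desR w j = evalAt (oneLine w) (suc j) <ᵇ evalAt (oneLine w) j

deltaIdx : ℕ → List ℕ
deltaIdx m = map suc (upTo (m ∸ 1))

_⇔ᵇ_ : Bool → Bool → Bool
a ⇔ᵇ b = (a ∧ b) ∨ (not a ∧ not b)

_⇒ᵇ_ : Bool → Bool → Bool
a ⇒ᵇ b = not a ∨ b

inD : (m : ℕ) → Subset → Subset → Vec (Fin m) m → Bool
inD m J K w = and (map (λ j → (desL w j ⇔ᵇ not (J j)) ∧ (desR w j ⇒ᵇ not (K j))) (deltaIdx m))

cardD : (m : ℕ) → Subset → Subset → ℕ
cardD m J K = length (filter (λ w → T? (inD m J K w)) (Sym m))

A : (m : ℕ) → List ℕ → List ℕ → ℕ
A m λ' μ' = cardD m (JJset λ') (Jset μ')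

-- A(λ, μ) counts the permutations u of {1,…,n} (in one-line notation) with
-- Des_L(u) = Δ ∖ {partial sums of λ^∨} and Des_R(u) ⊆ {partial sums of μ};
-- the second condition says that u increases on consecutive blocks of
-- lengths μ₁, μ₂, …. The proof deletes one column at a time. Let
-- p = λ^∨₁ = μ^∨₁ be the common number of parts, so λ^∨ = p ∷ λ[1]^∨.
-- The left-descent condition forces p, p-1, …, 1 to appear in this order;
-- since the p blocks increase, each block contains exactly one of these
-- values, as its first entry, and block i starts with p+1-i. Deleting the
-- block heads and subtracting p from the other entries is a bijection onto
-- the permutations counted by A(λ[1], μ[1]).

module Submission where

open import Defs
open import Data.Empty using (⊥; ⊥-elim)
open import Data.Unit using (tt; ⊤)
open import Data.Bool using (Bool; true; false; not; _∧_; _∨_; T)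
open import Data.Bool.ListAction using (and)
open import Data.Nat using (ℕ; zero; suc; _+_; _∸_; _≤_; _<_; z≤n; s≤s; _<ᵇ_; _≡ᵇ_; _≤?_; _<?_; _≟_)
open import Data.Nat.Properties
open import Algebra.Properties.CommutativeSemigroup +-commutativeSemigroup using (x∙yz≈y∙xz)
open import Data.Nat.ListAction using (sum)
open import Data.Fin using (Fin; toℕ; fromℕ<) renaming (_≟_ to _≟F_)
open import Data.Fin.Properties using (toℕ-injective; toℕ<n; toℕ-fromℕ<)
open import Data.Product using (∃; _×_; _,_; proj₁; proj₂)
open import Data.Sum using (_⊎_; inj₁; inj₂; [_,_]′)
open import Data.Vec using (Vec; []; _∷_; toList)
open import Data.Vec.Properties using (length-toList)
open import Data.List using (List; []; _∷_; length; map; filter; _++_; take; drop; upTo; applyUpTo)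
open import Data.List.Properties
  using (length-map; length-++; length-take; length-drop; length-upTo; map-∘; map-id-local; map-cong; map-injective;
         map-applyUpTo; map-upTo; ∷-injectiveˡ; ∷-injectiveʳ; take++drop≡id; filter-++; filter-none; filter-reject)
open import Data.List.Membership.Propositional using (_∈_; _∉_)
open import Data.List.Membership.Propositional.Properties
  using (∈-map⁺; ∈-map⁻; ∈-filter⁺; ∈-filter⁻; ∈-concatMap⁺; ∈-allFin; ∈-upTo⁺; ∈-upTo⁻; ∈-++⁺ˡ; ∈-++⁺ʳ; ∈-++⁻)
open import Data.List.Membership.Propositional.Properties.WithK using (unique∧set⇒bag)
import Data.List.Membership.DecPropositional as DecMembership
open import Data.List.Relation.Binary.BagAndSetEquality using (∼bag⇒↭)
open import Data.List.Relation.Binary.Permutation.Propositional.Properties using (↭-length)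
open import Data.List.Relation.Binary.Disjoint.Propositional using (Disjoint)
open import Data.List.Relation.Unary.Any using (here; there)
import Data.List.Relation.Unary.Any as Any
open import Data.List.Relation.Unary.All as All using (All; []; _∷_)
import Data.List.Relation.Unary.All.Properties as All
import Data.List.Relation.Unary.AllPairs as AllPairs
import Data.List.Relation.Unary.AllPairs.Properties as AllPairs
open import Data.List.Relation.Unary.Linked using (Linked; []; [-]; _∷_)
import Data.List.Relation.Unary.Linked.Properties as Linked
open import Data.List.Relation.Unary.Unique.Propositional using (Unique; []; _∷_)
import Data.List.Relation.Unary.Unique.Propositional.Properties as Unique
import Data.List.Relation.Unary.Unique.DecPropositional as UniqueDec
open import Function.Bundles using (mk⇔)
open import Relation.Binary.Definitions using (tri<; tri≈; tri>)
open import Relation.Binary.PropositionalEquality using (_≡_; _≢_; refl; sym; trans; cong; cong₂; subst; subst₂; module ≡-Reasoning)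
open import Relation.Nullary using (¬_; yes; no; does)
open import Relation.Nullary.Decidable using (T?)
open import Relation.Unary using (Decidable)

-- A duplicate-free list contained in ys is no longer than ys: delete the
-- head's occurrence from ys and recurse.
unique-⊆⇒length≤ : {A : Set} {xs ys : List A} → Unique xs → (∀ {z} → z ∈ xs → z ∈ ys) →
  length xs ≤ length ys
unique-⊆⇒length≤ {xs = []} _ _ = z≤n
unique-⊆⇒length≤ {xs = x ∷ xs} {ys} (x∉xs ∷ uxs) xs⊆ys =
  subst (suc (length xs) ≤_) (length-remove ys (xs⊆ys (here refl)))
    (s≤s (unique-⊆⇒length≤ uxs (λ z∈ → ∈-remove ys _ (xs⊆ys (there z∈)) (λ { refl → All.lookup x∉xs z∈ refl }))))
  where
  remove : ∀ {A : Set} {x : A} (ys : List A) → x ∈ ys → List A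
  remove (y ∷ ys) (here _)  = ys
  remove (y ∷ ys) (there p) = y ∷ remove ys p

  length-remove : ∀ {A : Set} {x : A} (ys : List A) (p : x ∈ ys) → suc (length (remove ys p)) ≡ length ys
  length-remove (y ∷ ys) (here _)  = refl
  length-remove (y ∷ ys) (there p) = cong suc (length-remove ys p)

  ∈-remove : ∀ {A : Set} {x z : A} (ys : List A) (p : x ∈ ys) → z ∈ ys → z ≢ x → z ∈ remove ys p
  ∈-remove (y ∷ ys) (here refl) (here refl) z≢x = ⊥-elim (z≢x refl)
  ∈-remove (y ∷ ys) (here refl) (there q)   _   = q
  ∈-remove (y ∷ ys) (there p)   (here refl) _   = here refl
  ∈-remove (y ∷ ys) (there p)   (there q)   z≢x = there (∈-remove ys p q z≢x)

length-≡-by-inverses : {A B : Set} {xs : List A} {ys : List B} → Unique xs → Unique ys →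
  (f : A → B) (g : B → A) →
  (∀ {x} → x ∈ xs → f x ∈ ys) → (∀ {y} → y ∈ ys → g y ∈ xs) →
  (∀ {x} → x ∈ xs → g (f x) ≡ x) → (∀ {y} → y ∈ ys → f (g y) ≡ y) →
  length xs ≡ length ys
length-≡-by-inverses {xs = xs} {ys} uxs uys f g f∈ g∈ gf fg =
  trans (sym (length-map f xs)) (↭-length (∼bag⇒↭ (unique∧set⇒bag ufxs uys (λ {z} → mk⇔ (to {z}) (from {z})))))
  where
  ufxs : Unique (map f xs)
  ufxs = Unique.map⁻ {f = g} (subst Unique (trans (sym (map-id-local (All.tabulate gf))) (map-∘ xs)) uxs)

  to : ∀ {z} → z ∈ map f xs → z ∈ ys
  to z∈ with ∈-map⁻ f z∈
  ... | x , x∈ , refl = f∈ x∈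

  from : ∀ {z} → z ∈ ys → z ∈ map f xs
  from z∈ = subst (_∈ map f xs) (fg z∈) (∈-map⁺ f (g∈ z∈))

InRange : ℕ → ℕ → Set
InRange n x = 1 ≤ x × x ≤ n

IsPerm : ℕ → List ℕ → Set
IsPerm n u = Unique u × length u ≡ n × All (InRange n) u

perms : ℕ → List (List ℕ)
perms m = map oneLine (Sym m)

∈-allVecs : (m k : ℕ) (w : Vec (Fin m) k) → w ∈ allVecs m k
∈-allVecs m zero    []      = here refl
∈-allVecs m (suc k) (i ∷ w) =
  ∈-concatMap⁺ (λ j → map (j ∷_) (allVecs m k)) (Any.map (λ { refl → ∈-map⁺ (i ∷_) (∈-allVecs m k w) }) (∈-allFin i))

unique-allVecs : (m k : ℕ) → Unique (allVecs m k)
unique-allVecs m zero    = [] ∷ []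
unique-allVecs m (suc k) =
  Unique.concat⁺ (All.map⁺ (All.tabulate (λ _ → Unique.map⁺ tail-≡ (unique-allVecs m k))))
    (AllPairs.map⁺ (AllPairs.map disjoint (Unique.allFin⁺ m)))
  where
  tail-≡ : {i : Fin m} {a b : Vec (Fin m) k} → _≡_ {A = Vec (Fin m) (suc k)} (i ∷ a) (i ∷ b) → a ≡ b
  tail-≡ refl = refl
  disjoint : {i j : Fin m} → i ≢ j → ∀ {v} → v ∈ map (i ∷_) (allVecs m k) × v ∈ map (j ∷_) (allVecs m k) → ⊥
  disjoint {i} {j} i≢j (v∈i , v∈j) with ∈-map⁻ (i ∷_) v∈i | ∈-map⁻ (j ∷_) v∈j
  ... | _ , _ , refl | _ , _ , refl = i≢j refl

toList-injective : {A : Set} {k : ℕ} (a b : Vec A k) → toList a ≡ toList b → a ≡ b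
toList-injective []      []      _ = refl
toList-injective (x ∷ a) (y ∷ b) e = cong₂ _∷_ (∷-injectiveˡ e) (toList-injective a b (∷-injectiveʳ e))

oneLine-injective : {m : ℕ} {a b : Vec (Fin m) m} → oneLine a ≡ oneLine b → a ≡ b
oneLine-injective {a = a} {b} e = toList-injective a b (map-injective (λ x → toℕ-injective (suc-injective x)) e)

perms-unique : (m : ℕ) → Unique (perms m)
perms-unique m = Unique.map⁺ oneLine-injective (Unique.filter⁺ _ (unique-allVecs m m))

perms-sound : (m : ℕ) {u : List ℕ} → u ∈ perms m → IsPerm m u
perms-sound m u∈ with ∈-map⁻ oneLine u∈
... | w , w∈ , refl with ∈-filter⁻ (λ w → UniqueDec.unique? _≟F_ (toList w)) {xs = allVecs m m} w∈
... | _ , uw =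
  Unique.map⁺ (λ x → toℕ-injective (suc-injective x)) uw ,
  trans (length-map _ (toList w)) (length-toList w) ,
  All.map⁺ (All.tabulate (λ {i} _ → s≤s z≤n , toℕ<n i))

perms-complete : (m : ℕ) {u : List ℕ} → IsPerm m u → u ∈ perms m
perms-complete m {u} (uu , len , rs) =
  subst (_∈ perms m) oneLine-w (∈-map⁺ oneLine (∈-filter⁺ (λ w → UniqueDec.unique? _≟F_ (toList w)) (∈-allVecs m m w) uw))
  where
  toFins : (v : List ℕ) → All (InRange m) v → Vec (Fin m) (length v)
  toFins []          []                = []
  toFins (suc x ∷ v) ((_ , x<m) ∷ rs) = fromℕ< x<m ∷ toFins v rs

  oneLine-toFins : (v : List ℕ) (rs : All (InRange m) v) → map (λ i → suc (toℕ i)) (toList (toFins v rs)) ≡ v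
  oneLine-toFins []          []                = refl
  oneLine-toFins (suc x ∷ v) ((_ , x<m) ∷ rs) = cong₂ _∷_ (cong suc (toℕ-fromℕ< x<m)) (oneLine-toFins v rs)

  toList-subst : {k : ℕ} (e : k ≡ m) (v : Vec (Fin m) k) → toList (subst (Vec (Fin m)) e v) ≡ toList v
  toList-subst refl v = refl

  w : Vec (Fin m) m
  w = subst (Vec (Fin m)) len (toFins u rs)

  oneLine-w : oneLine w ≡ u
  oneLine-w = trans (cong (map (λ i → suc (toℕ i))) (toList-subst len (toFins u rs))) (oneLine-toFins u rs)

  uw : Unique (toList w)
  uw = Unique.map⁻ (subst Unique (sym oneLine-w) uu)

range1 : ℕ → List ℕ
range1 K = map suc (upTo K)

range1-unique : ∀ K → Unique (range1 K)
range1-unique K = Unique.map⁺ suc-injective (Unique.upTo⁺ K)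

range1-length : ∀ K → length (range1 K) ≡ K
range1-length K = trans (length-map suc (upTo K)) (length-upTo K)

∈-range1⁺ : ∀ {K v} → InRange K v → v ∈ range1 K
∈-range1⁺ {v = suc v} (_ , v<K) = ∈-map⁺ suc (∈-upTo⁺ v<K)

∈-range1⁻ : ∀ {K v} → v ∈ range1 K → InRange K v
∈-range1⁻ v∈ with ∈-map⁻ suc v∈
... | i , i∈ , refl = s≤s z≤n , ∈-upTo⁻ i∈

-- Pigeonhole: a permutation of {1,…,n} takes every value 1,…,n, since
-- otherwise v ∷ u would be n+1 distinct values among 1,…,n.
perm-surjective : ∀ {n u} → IsPerm n u → ∀ {v} → InRange n v → v ∈ u
perm-surjective {n} {u} (uu , len , rs) {v} v-in with DecMembership._∈?_ _≟_ v u
... | yes v∈u = v∈u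
... | no  v∉u = ⊥-elim (<-irrefl refl (subst₂ _≤_ (cong suc len) (range1-length n) too-many))
  where
  too-many : length (v ∷ u) ≤ length (range1 n)
  too-many = unique-⊆⇒length≤ (All.tabulate (λ { z∈ refl → v∉u z∈ }) ∷ uu)
    (λ { (here refl) → ∈-range1⁺ v-in ; (there z∈) → ∈-range1⁺ (All.lookup rs z∈) })

data Before : List ℕ → ℕ → ℕ → Set where
  bhere  : ∀ {a b xs}   → b ∈ xs → Before (a ∷ xs) a b
  bthere : ∀ {x a b xs} → Before xs a b → Before (x ∷ xs) a b

Before-∈ˡ : ∀ {xs a b} → Before xs a b → a ∈ xs
Before-∈ˡ (bhere _)  = here refl
Before-∈ˡ (bthere p) = there (Before-∈ˡ p)

Before-∈ʳ : ∀ {xs a b} → Before xs a b → b ∈ xs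
Before-∈ʳ (bhere q)  = there q
Before-∈ʳ (bthere p) = there (Before-∈ʳ p)

Before-∷⁻ : ∀ {x xs a b} → Before (x ∷ xs) a b → (x ≡ a × b ∈ xs) ⊎ Before xs a b
Before-∷⁻ (bhere q)  = inj₁ (refl , q)
Before-∷⁻ (bthere r) = inj₂ r

Before-++ʳ : ∀ xs {ys a b} → Before ys a b → Before (xs ++ ys) a b
Before-++ʳ []       p = p
Before-++ʳ (x ∷ xs) p = bthere (Before-++ʳ xs p)

Before-total : ∀ {xs a b} → a ∈ xs → b ∈ xs → a ≢ b → Before xs a b ⊎ Before xs b a
Before-total (here refl) (here refl) a≢b = ⊥-elim (a≢b refl)
Before-total (here refl) (there q)   _   = inj₁ (bhere q)
Before-total (there p)   (here refl) _   = inj₂ (bhere p)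
Before-total (there p)   (there q)   a≢b with Before-total p q a≢b
... | inj₁ r = inj₁ (bthere r)
... | inj₂ r = inj₂ (bthere r)

≡ᵇ-refl : ∀ v → T (v ≡ᵇ v)
≡ᵇ-refl v = ≡⇒≡ᵇ v v refl

≢⇒≡ᵇ-false : ∀ x v → x ≢ v → (x ≡ᵇ v) ≡ false
≢⇒≡ᵇ-false x v x≢v with x ≡ᵇ v in eq
... | false = refl
... | true  = ⊥-elim (x≢v (≡ᵇ⇒≡ x v (subst T (sym eq) tt)))

posOf-head : ∀ v xs → posOf (v ∷ xs) v ≡ 1
posOf-head v xs with v ≡ᵇ v | ≡ᵇ-refl v
... | true | _ = refl

posOf-∈ : ∀ {v xs} → v ∈ xs → ∃ λ k → posOf xs v ≡ suc k
posOf-∈ {v} {x ∷ xs} (here refl) = 0 , posOf-head v xs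
posOf-∈ {v} {x ∷ xs} (there p) with x ≡ᵇ v | posOf-∈ p
... | true  | _       = 0 , refl
... | false | k , e rewrite e = suc k , refl

posOf-there : ∀ {x v xs} → x ≢ v → v ∈ xs → posOf (x ∷ xs) v ≡ suc (posOf xs v)
posOf-there {x} {v} {xs} x≢v p rewrite ≢⇒≡ᵇ-false x v x≢v with posOf-∈ p
... | k , e rewrite e = refl

Before⇒posOf< : ∀ {xs a b} → Unique xs → a ≢ b → Before xs a b → posOf xs a < posOf xs b
Before⇒posOf< {a ∷ xs} {a} {b} _ a≢b (bhere q) with posOf-∈ q
... | k , e = subst₂ _<_ (sym (posOf-head a xs)) (sym (trans (posOf-there a≢b q) (cong suc e))) (s≤s (s≤s z≤n))
Before⇒posOf< {x ∷ xs} {a} {b} (x∉xs ∷ uxs) a≢b (bthere p) =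
  subst₂ _<_ (sym (posOf-there x≢a (Before-∈ˡ p))) (sym (posOf-there x≢b (Before-∈ʳ p)))
    (s≤s (Before⇒posOf< uxs a≢b p))
  where
  x≢a : x ≢ a
  x≢a refl = All.lookup x∉xs (Before-∈ˡ p) refl
  x≢b : x ≢ b
  x≢b refl = All.lookup x∉xs (Before-∈ʳ p) refl

posOf<⇒Before : ∀ {xs a b} → Unique xs → a ∈ xs → b ∈ xs → a ≢ b → posOf xs a < posOf xs b → Before xs a b
posOf<⇒Before u a∈ b∈ a≢b lt with Before-total a∈ b∈ a≢b
... | inj₁ r = r
... | inj₂ r = ⊥-elim (<-asym lt (Before⇒posOf< u (λ e → a≢b (sym e)) r))

T-ext : ∀ {x y : Bool} → (T x → T y) → (T y → T x) → x ≡ y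
T-ext {false} {false} _ _ = refl
T-ext {false} {true}  _ g = ⊥-elim (g tt)
T-ext {true}  {false} f _ = ⊥-elim (f tt)
T-ext {true}  {true}  _ _ = refl

posOf<ᵇ⇒Before : ∀ {xs a b} → Unique xs → a ∈ xs → b ∈ xs → a ≢ b → T (posOf xs a <ᵇ posOf xs b) → Before xs a b
posOf<ᵇ⇒Before u a∈ b∈ a≢b t = posOf<⇒Before u a∈ b∈ a≢b (<ᵇ⇒< _ _ t)

Before⇒posOf<ᵇ : ∀ {xs a b} → Unique xs → a ≢ b → Before xs a b → T (posOf xs a <ᵇ posOf xs b)
Before⇒posOf<ᵇ u a≢b r = <⇒<ᵇ (Before⇒posOf< u a≢b r)

evalAt-++ˡ : ∀ (c w : List ℕ) i → suc i ≤ length c → evalAt (c ++ w) (suc i) ≡ evalAt c (suc i)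
evalAt-++ˡ (x ∷ c) w zero    _         = refl
evalAt-++ˡ (x ∷ c) w (suc i) (s≤s le) = evalAt-++ˡ c w i le

evalAt-++ʳ : ∀ (c w : List ℕ) i → evalAt (c ++ w) (length c + suc i) ≡ evalAt w (suc i)
evalAt-++ʳ []          w i = refl
evalAt-++ʳ (x ∷ [])    w i = refl
evalAt-++ʳ (x ∷ y ∷ c) w i = evalAt-++ʳ (y ∷ c) w i

isPartialSum : List ℕ → ℕ → Bool
isPartialSum ν j = elemℕ j (partialSums ν)

private
  <⇒≡ᵇ-false : ∀ j m → j < m → (j ≡ᵇ m) ≡ false
  <⇒≡ᵇ-false j m j<m = ≢⇒≡ᵇ-false j m (λ e → <-irrefl e j<m)

  elem-shift : ∀ m k xs → elemℕ (m + k) (map (m +_) xs) ≡ elemℕ k xs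
  elem-shift m k []       = refl
  elem-shift m k (x ∷ xs) = cong₂ _∨_ (shift-≡ᵇ m) (elem-shift m k xs)
    where
    shift-≡ᵇ : ∀ m → (m + k ≡ᵇ m + x) ≡ (k ≡ᵇ x)
    shift-≡ᵇ zero    = refl
    shift-≡ᵇ (suc m) = shift-≡ᵇ m

  elem-shift-below : ∀ m j xs → j < m → elemℕ j (map (m +_) xs) ≡ false
  elem-shift-below m j []       j<m = refl
  elem-shift-below m j (x ∷ xs) j<m
    rewrite <⇒≡ᵇ-false j (m + x) (<-≤-trans j<m (m≤m+n m x)) = elem-shift-below m j xs j<m

isPartialSum-below : ∀ m ν j → j < m → isPartialSum (m ∷ ν) j ≡ false
isPartialSum-below m []      j j<m = refl
isPartialSum-below m (b ∷ ν) j j<m rewrite <⇒≡ᵇ-false j m j<m = elem-shift-below m j (partialSums (b ∷ ν)) j<m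

isPartialSum-first : ∀ m b ν → isPartialSum (m ∷ b ∷ ν) m ≡ true
isPartialSum-first m b ν with m ≡ᵇ m | ≡ᵇ-refl m
... | true | _ = refl

isPartialSum-shift : ∀ m ν k → isPartialSum (m ∷ ν) (m + suc k) ≡ isPartialSum ν (suc k)
isPartialSum-shift m []      k = refl
isPartialSum-shift m (b ∷ ν) k
  rewrite ≢⇒≡ᵇ-false (m + suc k) m (λ e → <-irrefl (sym e) (m<m+n m (s≤s z≤n))) =
  elem-shift m (suc k) (partialSums (b ∷ ν))

descentAt : List ℕ → ℕ → Bool
descentAt u i = evalAt u (suc (suc i)) <ᵇ evalAt u (suc i)

DescentsIn : (ℕ → Bool) → List ℕ → Set
DescentsIn S u = ∀ i → suc i < length u → T (descentAt u i) → T (S (suc i))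

Increasing : List ℕ → Set
Increasing = Linked _≤_

IncreasingBlocks : List ℕ → List ℕ → Set
IncreasingBlocks []      u = ⊤
IncreasingBlocks (m ∷ ν) u = Increasing (take m u) × IncreasingBlocks ν (drop m u)

descentAt-++ˡ : ∀ c w i → suc (suc i) ≤ length c → descentAt (c ++ w) i ≡ descentAt c i
descentAt-++ˡ c w i le rewrite evalAt-++ˡ c w (suc i) le | evalAt-++ˡ c w i (≤-trans (n≤1+n _) le) = refl

descentAt-++ʳ : ∀ c w k → descentAt (c ++ w) (length c + k) ≡ descentAt w k
descentAt-++ʳ c w k = cong₂ _<ᵇ_
  (trans (cong (evalAt (c ++ w)) (trans (cong suc (sym (+-suc (length c) k))) (sym (+-suc (length c) (suc k)))))
         (evalAt-++ʳ c w (suc k)))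
  (trans (cong (evalAt (c ++ w)) (sym (+-suc (length c) k))) (evalAt-++ʳ c w k))

Increasing⇒no-descent : ∀ c → Increasing c → ∀ i → suc i < length c → ¬ T (descentAt c i)
Increasing⇒no-descent (x ∷ [])    [-]       i       (s≤s ())  t
Increasing⇒no-descent (x ∷ y ∷ c) (x≤y ∷ l) zero    _         t = <⇒≱ (<ᵇ⇒< y x t) x≤y
Increasing⇒no-descent (x ∷ y ∷ c) (x≤y ∷ l) (suc i) (s≤s lt) t = Increasing⇒no-descent (y ∷ c) l i lt t

no-descent⇒Increasing : ∀ c → (∀ i → suc i < length c → ¬ T (descentAt c i)) → Increasing c
no-descent⇒Increasing []          _ = []
no-descent⇒Increasing (x ∷ [])    _ = [-]
no-descent⇒Increasing (x ∷ y ∷ c) h =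
  ≮⇒≥ (λ y<x → h zero (s≤s (s≤s z≤n)) (<⇒<ᵇ y<x)) ∷ no-descent⇒Increasing (y ∷ c) (λ i lt → h (suc i) (s≤s lt))

length-take-+ : ∀ m s (u : List ℕ) → length u ≡ m + s → length (take m u) ≡ m
length-take-+ m s u e = trans (length-take m u) (m≤n⇒m⊓n≡m (subst (m ≤_) (sym e) (m≤m+n m s)))

length-drop-+ : ∀ m s (u : List ℕ) → length u ≡ m + s → length (drop m u) ≡ s
length-drop-+ m s u e = trans (length-drop m u) (trans (cong (_∸ m) e) (m+n∸m≡n m s))

-- Prepending one increasing block c keeps all descents at partial sums:
-- inside c there are none, at its end sits the partial sum |c|, and
-- later ones are shifted partial sums of ν.
descents-++⁺ : ∀ ν c w → Increasing c → length w ≡ sum ν → DescentsIn (isPartialSum ν) w →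
  DescentsIn (isPartialSum (length c ∷ ν)) (c ++ w)
descents-++⁺ ν c w inc lw ok i lt t with <-cmp (suc i) (length c)
... | tri< i+1<c _ _ = ⊥-elim (Increasing⇒no-descent c inc i i+1<c (subst T (descentAt-++ˡ c w i i+1<c) t))
... | tri≈ _ i+1≡c _ = boundary ν lw
  where
  boundary : ∀ ν → length w ≡ sum ν → T (isPartialSum (length c ∷ ν) (suc i))
  boundary []      lw = ⊥-elim (<-irrefl (trans i+1≡c (sym (trans (length-++ c) (trans (cong (length c +_) lw) (+-identityʳ _))))) lt)
  boundary (b ∷ ν) lw = subst T (sym (trans (cong (isPartialSum (length c ∷ b ∷ ν)) i+1≡c) (isPartialSum-first (length c) b ν))) tt
... | tri> _ _ c<i+1 with m≤n⇒∃[o]m+o≡n (≤-pred c<i+1)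
...   | k , refl =
  subst T (trans (sym (isPartialSum-shift (length c) ν k)) (cong (isPartialSum (length c ∷ ν)) (+-suc (length c) k)))
    (ok k k+1<w (subst T (descentAt-++ʳ c w k) t))
  where
  k+1<w : suc k < length w
  k+1<w = +-cancelˡ-< (length c) (suc k) (length w) (subst₂ _<_ (sym (+-suc (length c) k)) (length-++ c) lt)

descents-++⁻ : ∀ ν c w → DescentsIn (isPartialSum (length c ∷ ν)) (c ++ w) →
  Increasing c × DescentsIn (isPartialSum ν) w
descents-++⁻ ν c w ok = no-descent⇒Increasing c inside , after
  where
  inside : ∀ i → suc i < length c → ¬ T (descentAt c i)
  inside i lt t = subst T (isPartialSum-below (length c) ν (suc i) lt)
    (ok i (<-≤-trans lt (subst (length c ≤_) (sym (length-++ c)) (m≤m+n _ _))) (subst T (sym (descentAt-++ˡ c w i lt)) t))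
  after : DescentsIn (isPartialSum ν) w
  after k lt t = subst T (trans (cong (isPartialSum (length c ∷ ν)) (sym (+-suc (length c) k))) (isPartialSum-shift (length c) ν k))
    (ok (length c + k) (subst₂ _<_ (+-suc (length c) k) (sym (length-++ c)) (+-monoʳ-< (length c) lt))
      (subst T (sym (descentAt-++ʳ c w k)) t))

blocks⇒descents : ∀ ν u → length u ≡ sum ν → IncreasingBlocks ν u → DescentsIn (isPartialSum ν) u
blocks⇒descents []      u lu _ i lt _ = ⊥-elim (<⇒≱ (subst (suc i <_) lu lt) z≤n)
blocks⇒descents (m ∷ ν) u lu (inc , blocks) =
  subst₂ (λ a b → DescentsIn (isPartialSum (a ∷ ν)) b) (length-take-+ m (sum ν) u lu) (take++drop≡id m u)
    (descents-++⁺ ν (take m u) (drop m u) inc (length-drop-+ m (sum ν) u lu)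
      (blocks⇒descents ν (drop m u) (length-drop-+ m (sum ν) u lu) blocks))

descents⇒blocks : ∀ ν u → length u ≡ sum ν → DescentsIn (isPartialSum ν) u → IncreasingBlocks ν u
descents⇒blocks []      u lu _  = tt
descents⇒blocks (m ∷ ν) u lu ok =
  let (inc , ok′) = descents-++⁻ ν (take m u) (drop m u)
                      (subst₂ (λ a b → DescentsIn (isPartialSum (a ∷ ν)) b)
                        (sym (length-take-+ m (sum ν) u lu)) (sym (take++drop≡id m u)) ok)
  in inc , descents⇒blocks ν (drop m u) (length-drop-+ m (sum ν) u lu) ok′

LeftDescentsOff : ℕ → (ℕ → Bool) → List ℕ → Set
LeftDescentsOff m S u = ∀ i → suc i < m → (posOf u (suc (suc i)) <ᵇ posOf u (suc i)) ≡ not (S (suc i))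

Counted : ℕ → List ℕ → List ℕ → List ℕ → Set
Counted m lam mu u = IsPerm m u × LeftDescentsOff m (isPartialSum (dual lam)) u × DescentsIn (isPartialSum mu) u

countedᵇ : ℕ → List ℕ → List ℕ → List ℕ → Bool
countedᵇ m lam mu u =
  and (map (λ j → ((posOf u (suc j) <ᵇ posOf u j) ⇔ᵇ not (JJset lam j)) ∧ ((evalAt u (suc j) <ᵇ evalAt u j) ⇒ᵇ not (Jset mu j)))
           (deltaIdx m))

countedList : ℕ → List ℕ → List ℕ → List (List ℕ)
countedList m lam mu = filter (λ u → T? (countedᵇ m lam mu u)) (perms m)

length-filter-map : {A B : Set} {P : B → Set} (P? : Decidable P) (f : A → B) (xs : List A) →
  length (filter P? (map f xs)) ≡ length (filter (λ x → P? (f x)) xs)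
length-filter-map P? f []       = refl
length-filter-map P? f (x ∷ xs) with does (P? (f x))
... | true  = cong suc (length-filter-map P? f xs)
... | false = length-filter-map P? f xs

A-as-length : ∀ m lam mu → A m lam mu ≡ length (countedList m lam mu)
A-as-length m lam mu = sym (length-filter-map (λ u → T? (countedᵇ m lam mu u)) oneLine (Sym m))

private
  T-and⁻ : ∀ (f : ℕ → Bool) xs → T (and (map f xs)) → ∀ {x} → x ∈ xs → T (f x)
  T-and⁻ f (y ∷ xs) t (here refl) with f y
  ... | true = tt
  T-and⁻ f (y ∷ xs) t (there x∈) with f y
  ... | true = T-and⁻ f xs t x∈

  T-and⁺ : ∀ (f : ℕ → Bool) xs → (∀ {x} → x ∈ xs → T (f x)) → T (and (map f xs))
  T-and⁺ f []       h = tt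
  T-and⁺ f (y ∷ xs) h with f y | h (here refl)
  ... | true | _ = T-and⁺ f xs (λ q → h (there q))

  ∈-deltaIdx⁺ : ∀ m i → suc i < m → suc i ∈ deltaIdx m
  ∈-deltaIdx⁺ (suc m) i (s≤s lt) = ∈-map⁺ suc (∈-upTo⁺ lt)

  ∈-deltaIdx⁻ : ∀ m {j} → j ∈ deltaIdx m → ∃ λ i → j ≡ suc i × suc i < m
  ∈-deltaIdx⁻ (suc m) j∈ with ∈-map⁻ suc j∈
  ... | i , i∈ , e = i , e , s≤s (∈-upTo⁻ i∈)

  left-clause⁻ : ∀ a e → T (a ⇔ᵇ not (not (not e))) → a ≡ not e
  left-clause⁻ false true  _ = refl
  left-clause⁻ true  false _ = refl

  left-clause⁺ : ∀ a e → a ≡ not e → T (a ⇔ᵇ not (not (not e)))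
  left-clause⁺ false true  refl = tt
  left-clause⁺ true  false refl = tt

  right-clause⁻ : ∀ a e → T (a ⇒ᵇ not (not e)) → T a → T e
  right-clause⁻ true true _ _ = tt

  right-clause⁺ : ∀ a e → (T a → T e) → T (a ⇒ᵇ not (not e))
  right-clause⁺ false e     _ = tt
  right-clause⁺ true  false h = h tt
  right-clause⁺ true  true  _ = tt

  ∧-split : ∀ {a b} → T (a ∧ b) → T a × T b
  ∧-split {true} {true} _ = tt , tt

  ∧-join : ∀ {a b} → T a → T b → T (a ∧ b)
  ∧-join {true} {true} _ _ = tt

countedᵇ⁻ : ∀ m lam mu u → length u ≡ m → T (countedᵇ m lam mu u) →
  LeftDescentsOff m (isPartialSum (dual lam)) u × DescentsIn (isPartialSum mu) u
countedᵇ⁻ m lam mu u refl t =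
  (λ i lt → left-clause⁻ _ _ (proj₁ (clause i lt))) , (λ i lt → right-clause⁻ _ _ (proj₂ (clause i lt)))
  where
  clause : ∀ i → suc i < m → _
  clause i lt = ∧-split (T-and⁻ _ (deltaIdx m) t (∈-deltaIdx⁺ m i lt))

countedᵇ⁺ : ∀ m lam mu u → length u ≡ m →
  LeftDescentsOff m (isPartialSum (dual lam)) u → DescentsIn (isPartialSum mu) u → T (countedᵇ m lam mu u)
countedᵇ⁺ m lam mu u refl left right = T-and⁺ _ (deltaIdx m) clause
  where
  clause : ∀ {j} → j ∈ deltaIdx m → _
  clause j∈ with ∈-deltaIdx⁻ m j∈
  ... | i , refl , lt = ∧-join (left-clause⁺ _ _ (left i lt)) (right-clause⁺ _ _ (right i lt))

∈-countedList⁻ : ∀ m lam mu {u} → u ∈ countedList m lam mu → Counted m lam mu u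
∈-countedList⁻ m lam mu {u} u∈ with ∈-filter⁻ (λ u → T? (countedᵇ m lam mu u)) {xs = perms m} u∈
... | u∈perms , t = let perm = perms-sound m u∈perms in perm , countedᵇ⁻ m lam mu u (proj₁ (proj₂ perm)) t

∈-countedList⁺ : ∀ m lam mu {u} → Counted m lam mu u → u ∈ countedList m lam mu
∈-countedList⁺ m lam mu {u} (perm , left , right) =
  ∈-filter⁺ (λ u → T? (countedᵇ m lam mu u)) (perms-complete m perm) (countedᵇ⁺ m lam mu u (proj₁ (proj₂ perm)) left right)

countedList-unique : ∀ m lam mu → Unique (countedList m lam mu)
countedList-unique m lam mu = Unique.filter⁺ _ (perms-unique m)

positiveParts : List ℕ → List ℕ
positiveParts = filter (0 <?_)

All-positiveParts : ∀ xs → All (0 <_) (positiveParts xs)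
All-positiveParts []           = []
All-positiveParts (zero ∷ xs)  = All-positiveParts xs
All-positiveParts (suc a ∷ xs) = s≤s z≤n ∷ All-positiveParts xs

sum-positiveParts : ∀ xs → sum (positiveParts xs) ≡ sum xs
sum-positiveParts []           = refl
sum-positiveParts (zero ∷ xs)  = sum-positiveParts xs
sum-positiveParts (suc a ∷ xs) = cong (suc a +_) (sum-positiveParts xs)

-- Empty blocks impose nothing, so zero parts may be dropped.
IncreasingBlocks-positiveParts : ∀ ν w →
  (IncreasingBlocks ν w → IncreasingBlocks (positiveParts ν) w) × (IncreasingBlocks (positiveParts ν) w → IncreasingBlocks ν w)
IncreasingBlocks-positiveParts []          w = (λ _ → tt) , (λ _ → tt)
IncreasingBlocks-positiveParts (zero ∷ ν)  w =
  (λ (_ , bs) → proj₁ (IncreasingBlocks-positiveParts ν w) bs) , (λ bs → [] , proj₂ (IncreasingBlocks-positiveParts ν w) bs)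
IncreasingBlocks-positiveParts (suc m ∷ ν) w =
  (λ (inc , bs) → inc , proj₁ (IncreasingBlocks-positiveParts ν _) bs) ,
  (λ (inc , bs) → inc , proj₂ (IncreasingBlocks-positiveParts ν _) bs)

colLen-one : ∀ ν → All (0 <_) ν → colLen ν 1 ≡ length ν
colLen-one []      []             = refl
colLen-one (suc a ∷ ν) (_ ∷ pos) = cong suc (colLen-one ν pos)

colLen-dropCols : ∀ ν s → 1 ≤ s → colLen (dropCols 1 ν) s ≡ colLen ν (suc s)
colLen-dropCols []                 s       _ = refl
colLen-dropCols (zero ∷ ν)         s       s≥1 = colLen-dropCols ν s s≥1
colLen-dropCols (suc zero ∷ ν)     (suc s) s≥1 = colLen-dropCols ν (suc s) s≥1
colLen-dropCols (suc (suc a) ∷ ν) (suc s) s≥1 with s <ᵇ suc a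
... | true  = cong suc (colLen-dropCols ν (suc s) s≥1)
... | false = colLen-dropCols ν (suc s) s≥1

dropCols-suc : ∀ ℓ ν → dropCols (suc ℓ) ν ≡ dropCols ℓ (dropCols 1 ν)
dropCols-suc ℓ       []                = refl
dropCols-suc ℓ       (zero ∷ ν)        = dropCols-suc ℓ ν
dropCols-suc zero    (suc zero ∷ ν)    = dropCols-suc zero ν
dropCols-suc (suc ℓ) (suc zero ∷ ν)    = dropCols-suc (suc ℓ) ν
dropCols-suc ℓ       (suc (suc a) ∷ ν) with does (0 <? (suc a ∸ ℓ))
... | true  = cong (suc a ∸ ℓ ∷_) (dropCols-suc ℓ ν)
... | false = dropCols-suc ℓ ν

dropCols-zero : ∀ ν → All (0 <_) ν → dropCols 0 ν ≡ ν
dropCols-zero []          []        = refl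
dropCols-zero (suc a ∷ ν) (_ ∷ pos) = cong (suc a ∷_) (dropCols-zero ν pos)

length+sum-pred : ∀ ν → All (0 <_) ν → length ν + sum (map (_∸ 1) ν) ≡ sum ν
length+sum-pred []          []        = refl
length+sum-pred (suc a ∷ ν) (_ ∷ pos) =
  cong suc (trans (x∙yz≈y∙xz (length ν) a _) (cong (a +_) (length+sum-pred ν pos)))

length+sum-dropCols : ∀ ν → All (0 <_) ν → length ν + sum (dropCols 1 ν) ≡ sum ν
length+sum-dropCols ν pos = trans (cong (length ν +_) (sum-positiveParts (map (_∸ 1) ν))) (length+sum-pred ν pos)

Decreasing : List ℕ → Set
Decreasing = Linked (λ a b → b ≤ a)

dropCols-partition : ∀ n ν → IsPartition n ν → IsPartition (sum (dropCols 1 ν)) (dropCols 1 ν)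
dropCols-partition n ν (dec , _ , _) =
  Linked.filter⁺ (0 <?_) (λ p q → ≤-trans q p) (decreasing-pred ν dec) , All-positiveParts (map (_∸ 1) ν) , refl
  where
  decreasing-pred : ∀ xs → Decreasing xs → Decreasing (map (_∸ 1) xs)
  decreasing-pred []           _         = []
  decreasing-pred (x ∷ [])     _         = [-]
  decreasing-pred (x ∷ y ∷ xs) (y≤x ∷ l) = ∸-monoˡ-≤ 1 y≤x ∷ decreasing-pred (y ∷ xs) l

private
  bounded-by-head : ∀ a xs → Decreasing (a ∷ xs) → All (_≤ a) xs
  bounded-by-head a []       _          = []
  bounded-by-head a (y ∷ xs) (y≤a ∷ l) = y≤a ∷ All.map (λ z≤y → ≤-trans z≤y y≤a) (bounded-by-head y xs l)

  dropCols-ones : ∀ xs → All (_≤ 1) xs → dropCols 1 xs ≡ []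
  dropCols-ones []                 []              = refl
  dropCols-ones (zero ∷ xs)        (_ ∷ bounded)   = dropCols-ones xs bounded
  dropCols-ones (suc zero ∷ xs)    (_ ∷ bounded)   = dropCols-ones xs bounded
  dropCols-ones (suc (suc _) ∷ xs) (s≤s () ∷ _)

  head0-dropCols : ∀ a ν → Decreasing (suc a ∷ ν) → head0 (dropCols 1 (suc a ∷ ν)) ≡ a
  head0-dropCols zero    ν dec = cong head0 (dropCols-ones ν (bounded-by-head 1 ν dec))
  head0-dropCols (suc a) ν dec = refl

dual-cons : ∀ a ν → Decreasing (suc a ∷ ν) → All (0 <_) (suc a ∷ ν) →
  dual (suc a ∷ ν) ≡ length (suc a ∷ ν) ∷ dual (dropCols 1 (suc a ∷ ν))
dual-cons a ν dec pos = cong₂ _∷_ (colLen-one L pos) (begin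
  map column (applyUpTo suc a)      ≡⟨ map-applyUpTo suc column a ⟩
  applyUpTo (λ i → column (suc i)) a ≡⟨ sym (map-upTo (λ i → column (suc i)) a) ⟩
  map (λ i → column (suc i)) (upTo a) ≡⟨ map-cong (λ i → sym (colLen-dropCols L (suc i) (s≤s z≤n))) (upTo a) ⟩
  map (λ i → colLen L′ (suc i)) (upTo a) ≡⟨ cong (λ k → map (λ i → colLen L′ (suc i)) (upTo k)) (sym (head0-dropCols a ν dec)) ⟩
  dual L′                            ∎)
  where
  open ≡-Reasoning
  L L′ : List ℕ
  L = suc a ∷ ν
  L′ = dropCols 1 L
  column : ℕ → ℕ
  column i = colLen L (suc i)

isPartialSum-dual : ∀ p ν → 0 < sum ν → All (0 <_) ν → isPartialSum (p ∷ dual ν) p ≡ true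
isPartialSum-dual p []          ()  _
isPartialSum-dual p (zero ∷ ν)  _   (() ∷ _)
isPartialSum-dual p (suc b ∷ ν) _   _ =
  isPartialSum-first p (colLen (suc b ∷ ν) 1) (map (λ i → colLen (suc b ∷ ν) (suc i)) (applyUpTo suc b))

-- Stripped p μ u v: u consists of blocks of lengths μ₁, μ₂, …; the i-th of
-- the k = |μ| blocks starts with the value k+1-i, and deleting these heads
-- and subtracting p from all other entries leaves v.
data Stripped (p : ℕ) : List ℕ → List ℕ → List ℕ → Set where
  nil   : Stripped p [] [] []
  block : ∀ {μ u v c} → All (1 ≤_) c → Stripped p μ u v →
          Stripped p (suc (length c) ∷ μ) (suc (length μ) ∷ map (p +_) c ++ u) (c ++ v)

insertHeads : ℕ → List ℕ → List ℕ → List ℕ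
insertHeads p []      v = []
insertHeads p (m ∷ μ) v = suc (length μ) ∷ map (p +_) (take (m ∸ 1) v) ++ insertHeads p μ (drop (m ∸ 1) v)

deleteHeads : ℕ → List ℕ → List ℕ → List ℕ
deleteHeads p []      u = []
deleteHeads p (m ∷ μ) u = map (_∸ p) (take (m ∸ 1) (drop 1 u)) ++ deleteHeads p μ (drop m u)

private
  take-++-length : ∀ {A : Set} (xs ys : List A) → take (length xs) (xs ++ ys) ≡ xs
  take-++-length []       ys = refl
  take-++-length (x ∷ xs) ys = cong (x ∷_) (take-++-length xs ys)

  drop-++-length : ∀ {A : Set} (xs ys : List A) → drop (length xs) (xs ++ ys) ≡ ys
  drop-++-length []       ys = refl
  drop-++-length (x ∷ xs) ys = drop-++-length xs ys

  unshift : ∀ p c → map (_∸ p) (map (p +_) c) ≡ c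
  unshift p c = trans (sym (map-∘ c)) (map-id-local (All.tabulate (λ {x} _ → m+n∸m≡n p x)))

  take-shifted : ∀ p c u → take (length c) (map (p +_) c ++ u) ≡ map (p +_) c
  take-shifted p c u = subst (λ k → take k (map (p +_) c ++ u) ≡ map (p +_) c) (length-map (p +_) c) (take-++-length (map (p +_) c) u)

  drop-shifted : ∀ p c u → drop (length c) (map (p +_) c ++ u) ≡ u
  drop-shifted p c u = subst (λ k → drop k (map (p +_) c ++ u) ≡ u) (length-map (p +_) c) (drop-++-length (map (p +_) c) u)

Stripped⇒insertHeads : ∀ {p μ u v} → Stripped p μ u v → u ≡ insertHeads p μ v
Stripped⇒insertHeads nil = refl
Stripped⇒insertHeads {p} (block {μ} {u} {v} {c} _ s) =
  cong (suc (length μ) ∷_) (cong₂ _++_ (cong (map (p +_)) (sym (take-++-length c v)))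
                                       (trans (Stripped⇒insertHeads s) (cong (insertHeads p μ) (sym (drop-++-length c v)))))

Stripped⇒deleteHeads : ∀ {p μ u v} → Stripped p μ u v → v ≡ deleteHeads p μ u
Stripped⇒deleteHeads nil = refl
Stripped⇒deleteHeads {p} (block {μ} {u} {v} {c} _ s) =
  cong₂ _++_ (trans (sym (unshift p c)) (cong (map (_∸ p)) (sym (take-shifted p c u))))
             (trans (Stripped⇒deleteHeads s) (cong (deleteHeads p μ) (sym (drop-shifted p c u))))

insertHeads-Stripped : ∀ p μ → All (0 <_) μ → ∀ v → All (1 ≤_) v → length v ≡ sum (map (_∸ 1) μ) →
  Stripped p μ (insertHeads p μ v) v
insertHeads-Stripped p []          []        []      _   _  = nil
insertHeads-Stripped p (suc m ∷ μ) (_ ∷ pos) v       all lv =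
  subst₂ (λ k z → Stripped p (suc k ∷ μ) (suc (length μ) ∷ map (p +_) (take m v) ++ insertHeads p μ (drop m v)) z)
    (length-take-+ m _ v lv) (take++drop≡id m v)
    (block (All.take⁺ m all) (insertHeads-Stripped p μ pos (drop m v) (All.drop⁺ m all) (length-drop-+ m _ v lv)))

Stripped-length : ∀ {p μ u v} → Stripped p μ u v → length u ≡ length μ + length v
Stripped-length nil = refl
Stripped-length {p} (block {μ} {u} {v} {c} _ s) = cong suc (begin
  length (map (p +_) c ++ u)            ≡⟨ length-++ (map (p +_) c) ⟩
  length (map (p +_) c) + length u      ≡⟨ cong₂ _+_ (length-map (p +_) c) (Stripped-length s) ⟩
  length c + (length μ + length v)      ≡⟨ x∙yz≈y∙xz (length c) (length μ) (length v) ⟩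
  length μ + (length c + length v)      ≡⟨ cong (length μ +_) (sym (length-++ c)) ⟩
  length μ + length (c ++ v)            ∎)
  where open ≡-Reasoning

Stripped-length-sum : ∀ {p μ u v} → Stripped p μ u v → length u ≡ sum μ
Stripped-length-sum nil = refl
Stripped-length-sum {p} (block {μ} {u} {v} {c} _ s) =
  cong suc (trans (length-++ (map (p +_) c)) (cong₂ _+_ (length-map (p +_) c) (Stripped-length-sum s)))

Stripped-positive : ∀ {p μ u v} → Stripped p μ u v → All (1 ≤_) v
Stripped-positive nil           = []
Stripped-positive (block c≥1 s) = All.++⁺ c≥1 (Stripped-positive s)

Stripped-heads-∈ : ∀ {p μ u v} → Stripped p μ u v → ∀ x → 1 ≤ x → x ≤ length μ → x ∈ u
Stripped-heads-∈ nil x x≥1 x≤0 = ⊥-elim (<⇒≱ x≥1 x≤0)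
Stripped-heads-∈ {p} (block {μ} {c = c} _ s) x x≥1 x≤ with x ≟ suc (length μ)
... | yes refl = here refl
... | no  x≢   = there (∈-++⁺ʳ (map (p +_) c) (Stripped-heads-∈ s x x≥1 (≤-pred (≤∧≢⇒< x≤ x≢))))

Stripped-∈ : ∀ {p μ u v} → Stripped p μ u v → ∀ {x} → x ∈ u →
  (1 ≤ x × x ≤ length μ) ⊎ ∃ λ y → y ∈ v × x ≡ p + y
Stripped-∈ (block _ s) (here refl) = inj₁ (s≤s z≤n , ≤-refl)
Stripped-∈ {p} (block {μ} {u} {v} {c} _ s) (there x∈) with ∈-++⁻ (map (p +_) c) x∈
... | inj₁ x∈c with ∈-map⁻ (p +_) x∈c
...   | y , y∈ , e = inj₂ (y , ∈-++⁺ˡ y∈ , e)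
Stripped-∈ {p} (block {μ} {u} {v} {c} _ s) (there x∈) | inj₂ x∈u with Stripped-∈ s x∈u
...   | inj₁ (x≥1 , x≤) = inj₁ (x≥1 , m≤n⇒m≤1+n x≤)
...   | inj₂ (y , y∈ , e) = inj₂ (y , ∈-++⁺ʳ c y∈ , e)

Stripped-heads-Before : ∀ {p μ u v} → Stripped p μ u v → ∀ j → 1 ≤ j → suc j ≤ length μ → Before u (suc j) j
Stripped-heads-Before nil j _ ()
Stripped-heads-Before {p} (block {μ} {c = c} _ s) j j≥1 j<  with suc j ≟ suc (length μ)
... | yes refl = bhere (∈-++⁺ʳ (map (p +_) c) (Stripped-heads-∈ s j j≥1 ≤-refl))
... | no  j≢   = bthere (Before-++ʳ (map (p +_) c) (Stripped-heads-Before s j j≥1 (≤-pred (≤∧≢⇒< j< j≢))))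

record Shifted (p : ℕ) (u v : List ℕ) : Set where
  field
    shift-∈⁺      : ∀ {y} → y ∈ v → p + y ∈ u
    shift-∈⁻      : ∀ {y} → 1 ≤ y → p + y ∈ u → y ∈ v
    shift-Before⁺ : ∀ {a b} → Before v a b → Before u (p + a) (p + b)
    shift-Before⁻ : ∀ {a b} → 1 ≤ a → 1 ≤ b → Before u (p + a) (p + b) → Before v a b

open Shifted public

private
  small≢shifted : ∀ {p h y} → h ≤ p → 1 ≤ y → h ≢ p + y
  small≢shifted {p} {h} {y} h≤p y≥1 e = <-irrefl e (≤-<-trans h≤p (subst (_< p + y) (+-identityʳ p) (+-monoʳ-< p y≥1)))

  Shifted-[] : ∀ p → Shifted p [] []
  Shifted-[] p = record { shift-∈⁺ = λ () ; shift-∈⁻ = λ _ () ; shift-Before⁺ = λ () ; shift-Before⁻ = λ _ _ () }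

  Shifted-head : ∀ {p h u v} → h ≤ p → Shifted p u v → Shifted p (h ∷ u) v
  Shifted-head h≤p sh = record
    { shift-∈⁺      = λ y∈ → there (shift-∈⁺ sh y∈)
    ; shift-∈⁻      = λ { y≥1 (here e) → ⊥-elim (small≢shifted h≤p y≥1 (sym e)) ; y≥1 (there q) → shift-∈⁻ sh y≥1 q }
    ; shift-Before⁺ = λ r → bthere (shift-Before⁺ sh r)
    ; shift-Before⁻ = λ a≥1 b≥1 r → [ (λ (h≡ , _) → ⊥-elim (small≢shifted h≤p a≥1 h≡)) , shift-Before⁻ sh a≥1 b≥1 ]′ (Before-∷⁻ r)
    }

  Shifted-++ : ∀ {p u v} c → Shifted p u v → Shifted p (map (p +_) c ++ u) (c ++ v)
  Shifted-++ []      sh = sh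
  Shifted-++ {p} (x ∷ c) sh = record
    { shift-∈⁺      = λ { (here refl) → here refl ; (there q) → there (shift-∈⁺ sh′ q) }
    ; shift-∈⁻      = λ { _ (here e) → here (+-cancelˡ-≡ p _ _ e) ; y≥1 (there q) → there (shift-∈⁻ sh′ y≥1 q) }
    ; shift-Before⁺ = λ { (bhere q) → bhere (shift-∈⁺ sh′ q) ; (bthere r) → bthere (shift-Before⁺ sh′ r) }
    ; shift-Before⁻ = λ {a} {b} a≥1 b≥1 r →
        [ (λ (x≡a , b∈) → subst (λ z → Before (x ∷ c ++ _) z b) (+-cancelˡ-≡ p x a x≡a) (bhere (shift-∈⁻ sh′ b≥1 b∈)))
        , (λ r′ → bthere (shift-Before⁻ sh′ a≥1 b≥1 r′)) ]′ (Before-∷⁻ r)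
    }
    where
    sh′ : Shifted p (map (p +_) c ++ _) (c ++ _)
    sh′ = Shifted-++ c sh

-- Stripping relates u and v by raising, since all heads are at most |μ| ≤ p.
Stripped⇒Shifted : ∀ {p μ u v} → Stripped p μ u v → length μ ≤ p → Shifted p u v
Stripped⇒Shifted {p} nil _ = Shifted-[] p
Stripped⇒Shifted (block {c = c} _ s) μ≤p = Shifted-head μ≤p (Shifted-++ c (Stripped⇒Shifted s (≤-trans (n≤1+n _) μ≤p)))

Unique-++⁻ : ∀ (xs : List ℕ) {ys} → Unique (xs ++ ys) → Unique xs × Unique ys × Disjoint xs ys
Unique-++⁻ []       u          = [] , u , λ ()
Unique-++⁻ (x ∷ xs) (x∉ ∷ u) with Unique-++⁻ xs u
... | uxs , uys , disjoint = All.++⁻ˡ xs x∉ ∷ uxs , uys , λ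
  { (here refl , v∈ys) → All.lookup (All.++⁻ʳ xs x∉) v∈ys refl
  ; (there v∈xs , v∈ys) → disjoint (v∈xs , v∈ys) }

Stripped-unique⁻ : ∀ {p μ u v} → Stripped p μ u v → length μ ≤ p → Unique u → Unique v
Stripped-unique⁻ nil _ u! = u!
Stripped-unique⁻ {p} (block {μ} {c = c} _ s) μ≤p (_ ∷ u!) with Unique-++⁻ (map (p +_) c) u!
... | pc! , rest! , disjoint =
  Unique.++⁺ (Unique.map⁻ pc!) (Stripped-unique⁻ s μ≤p′ rest!)
    (λ (y∈c , y∈v) → disjoint (∈-map⁺ (p +_) y∈c , shift-∈⁺ (Stripped⇒Shifted s μ≤p′) y∈v))
  where
  μ≤p′ : length μ ≤ p
  μ≤p′ = ≤-trans (n≤1+n _) μ≤p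

Stripped-unique⁺ : ∀ {p μ u v} → Stripped p μ u v → length μ ≤ p → Unique v → Unique u
Stripped-unique⁺ nil _ v! = v!
Stripped-unique⁺ {p} (block {μ} {u} {v} {c} c≥1 s) μ≤p cv! with Unique-++⁻ c cv!
... | c! , v! , disjoint =
  All.tabulate (λ x∈ e → head∉ (subst (_∈ _) (sym e) x∈)) ∷ Unique.++⁺ (Unique.map⁺ (+-cancelˡ-≡ p _ _) c!) u! raised-new
  where
  μ≤p′ : length μ ≤ p
  μ≤p′ = ≤-trans (n≤1+n _) μ≤p
  u! : Unique u
  u! = Stripped-unique⁺ s μ≤p′ v!
  head∉ : suc (length μ) ∉ map (p +_) c ++ u
  head∉ h∈ with ∈-++⁻ (map (p +_) c) h∈
  ... | inj₁ h∈c with ∈-map⁻ (p +_) h∈c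
  ...   | y , y∈ , e = small≢shifted μ≤p (All.lookup c≥1 y∈) e
  head∉ h∈ | inj₂ h∈u with Stripped-∈ s h∈u
  ...   | inj₁ (_ , h≤) = <-irrefl refl h≤
  ...   | inj₂ (y , y∈ , e) = small≢shifted μ≤p (All.lookup (Stripped-positive s) y∈) e
  raised-new : Disjoint (map (p +_) c) u
  raised-new (x∈c , x∈u) with ∈-map⁻ (p +_) x∈c
  ... | y , y∈c , refl with Stripped-∈ s x∈u
  ...   | inj₁ (_ , x≤) = small≢shifted (≤-trans x≤ μ≤p′) (All.lookup c≥1 y∈c) refl
  ...   | inj₂ (z , z∈v , e) = disjoint (y∈c , subst (_∈ v) (sym (+-cancelˡ-≡ p y z e)) z∈v)

Increasing-head-raised : ∀ p h c → h ≤ p →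
  (Increasing (h ∷ map (p +_) c) → Increasing c) × (Increasing c → Increasing (h ∷ map (p +_) c))
Increasing-head-raised p h []      _   = (λ _ → []) , (λ _ → [-])
Increasing-head-raised p h (y ∷ c) h≤p = (λ { (_ ∷ inc) → lower (y ∷ c) inc }) , (λ inc → ≤-trans h≤p (m≤m+n p y) ∷ raise (y ∷ c) inc)
  where
  lower : ∀ c → Increasing (map (p +_) c) → Increasing c
  lower []          _         = []
  lower (x ∷ [])    _         = [-]
  lower (x ∷ z ∷ c) (r ∷ inc) = +-cancelˡ-≤ p x z r ∷ lower (z ∷ c) inc
  raise : ∀ c → Increasing c → Increasing (map (p +_) c)
  raise []          _         = []
  raise (x ∷ [])    _         = [-]
  raise (x ∷ z ∷ c) (r ∷ inc) = +-monoʳ-≤ p r ∷ raise (z ∷ c) inc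

Stripped-blocks : ∀ {p μ u v} → Stripped p μ u v → length μ ≤ p →
  (IncreasingBlocks μ u → IncreasingBlocks (map (_∸ 1) μ) v) × (IncreasingBlocks (map (_∸ 1) μ) v → IncreasingBlocks μ u)
Stripped-blocks nil _ = (λ _ → tt) , (λ _ → tt)
Stripped-blocks {p} (block {μ} {u} {v} {c} _ s) μ≤p = to , from
  where
  rest : (IncreasingBlocks μ u → IncreasingBlocks (map (_∸ 1) μ) v) × (IncreasingBlocks (map (_∸ 1) μ) v → IncreasingBlocks μ u)
  rest = Stripped-blocks s (≤-trans (n≤1+n _) μ≤p)
  head : (Increasing (suc (length μ) ∷ map (p +_) c) → Increasing c) × (Increasing c → Increasing (suc (length μ) ∷ map (p +_) c))
  head = Increasing-head-raised p (suc (length μ)) c μ≤p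
  to : IncreasingBlocks (suc (length c) ∷ μ) (suc (length μ) ∷ map (p +_) c ++ u) → IncreasingBlocks (map (_∸ 1) (suc (length c) ∷ μ)) (c ++ v)
  to (inc , bs) =
    subst Increasing (sym (take-++-length c v)) (proj₁ head (subst (λ z → Increasing (suc (length μ) ∷ z)) (take-shifted p c u) inc)) ,
    subst (IncreasingBlocks (map (_∸ 1) μ)) (sym (drop-++-length c v)) (proj₁ rest (subst (IncreasingBlocks μ) (drop-shifted p c u) bs))
  from : IncreasingBlocks (map (_∸ 1) (suc (length c) ∷ μ)) (c ++ v) → IncreasingBlocks (suc (length c) ∷ μ) (suc (length μ) ∷ map (p +_) c ++ u)
  from (inc , bs) =
    subst (λ z → Increasing (suc (length μ) ∷ z)) (sym (take-shifted p c u)) (proj₂ head (subst Increasing (take-++-length c v) inc)) ,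
    subst (IncreasingBlocks μ) (sym (drop-shifted p c u)) (proj₂ rest (subst (IncreasingBlocks (map (_∸ 1) μ)) (drop-++-length c v) bs))

SmallDecreasing : ℕ → List ℕ → Set
SmallDecreasing K u = ∀ {a b} → 1 ≤ a → a < b → b ≤ K → ¬ Before u a b

Before-drop : ∀ m {xs a b} → Before (drop m xs) a b → Before xs a b
Before-drop zero    r = r
Before-drop (suc m) {x ∷ xs} r = bthere (Before-drop m r)

∈-take : ∀ m {xs} {y : ℕ} → y ∈ take m xs → y ∈ xs
∈-take m {xs} y∈ = subst (_ ∈_) (take++drop≡id m xs) (∈-++⁺ˡ y∈)

∈-drop : ∀ m {xs} {y : ℕ} → y ∈ drop m xs → y ∈ xs
∈-drop m {xs} y∈ = subst (_ ∈_) (take++drop≡id m xs) (∈-++⁺ʳ (take m xs) y∈)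

-- Within an increasing block x ∷ t headed by a positive value, the
-- entries after the head are all larger than K: a small one would
-- exceed the head and hence follow a smaller small value.
large-after-head : ∀ {K x m w} → Increasing (x ∷ take m w) → Unique (x ∷ w) → 1 ≤ x →
  SmallDecreasing K (x ∷ w) → All (K <_) (take m w)
large-after-head {K} {x} {m} {w} inc (x∉w ∷ _) x≥1 small = All.tabulate large
  where
  x≤ : All (x ≤_) (take m w)
  x≤ with Linked.Linked⇒AllPairs ≤-trans inc
  ... | x≤t ∷ _ = x≤t
  large : ∀ {y} → y ∈ take m w → K < y
  large {y} y∈ = ≰⇒> (λ y≤K → small x≥1 (≤∧≢⇒< (All.lookup x≤ y∈) (All.lookup x∉w (∈-take m y∈))) y≤K (bhere (∈-take m y∈)))

small-beyond-block : ∀ {K x m w} → Increasing (x ∷ take m w) → Unique (x ∷ w) → 1 ≤ x →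
  SmallDecreasing K (x ∷ w) → filter (_≤? K) w ≡ filter (_≤? K) (drop m w)
small-beyond-block {K} {x} {m} {w} inc w! x≥1 small = begin
  filter (_≤? K) w                                         ≡⟨ cong (filter (_≤? K)) (sym (take++drop≡id m w)) ⟩
  filter (_≤? K) (take m w ++ drop m w)                    ≡⟨ filter-++ (_≤? K) (take m w) (drop m w) ⟩
  filter (_≤? K) (take m w) ++ filter (_≤? K) (drop m w)  ≡⟨ cong (_++ filter (_≤? K) (drop m w)) (filter-none (_≤? K) (All.map <⇒≱ (large-after-head inc w! x≥1 small))) ⟩
  filter (_≤? K) (drop m w)                                ∎
  where open ≡-Reasoning

private
  length-filter-∷ : ∀ K x (ys : List ℕ) → length (filter (_≤? K) (x ∷ ys)) ≤ suc (length (filter (_≤? K) ys))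
  length-filter-∷ K x ys with does (x ≤? K)
  ... | true  = ≤-refl
  ... | false = n≤1+n _

  unique-tail : ∀ {x : ℕ} {xs} → Unique (x ∷ xs) → Unique xs
  unique-tail (_ ∷ xs!) = xs!

-- There is at most one value ≤ K per block, namely its head.
count-small : ∀ K ν w → All (0 <_) ν → length w ≡ sum ν → IncreasingBlocks ν w → Unique w → All (1 ≤_) w →
  SmallDecreasing K w → length (filter (_≤? K) w) ≤ length ν
count-small K []          []      _         _  _          _  _            _     = z≤n
count-small K []          (_ ∷ _) _         () _          _  _            _
count-small K (zero ∷ ν)  _       (() ∷ _)  _  _          _  _            _
count-small K (suc m ∷ ν) []      _         () _          _  _            _
count-small K (suc m ∷ ν) (x ∷ w) (_ ∷ pos) lw (inc , bs) w! (x≥1 ∷ w≥1) small = begin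
  length (filter (_≤? K) (x ∷ w))          ≤⟨ length-filter-∷ K x w ⟩
  suc (length (filter (_≤? K) w))          ≡⟨ cong (λ ys → suc (length ys)) (small-beyond-block inc w! x≥1 small) ⟩
  suc (length (filter (_≤? K) (drop m w))) ≤⟨ s≤s (count-small K ν (drop m w) pos (length-drop-+ m (sum ν) w (suc-injective lw)) bs
                                                 (Unique.drop⁺ m (unique-tail w!)) (All.drop⁺ m w≥1)
                                                 (λ a≥1 a<b b≤K r → small a≥1 a<b b≤K (bthere (Before-drop m r)))) ⟩
  suc (length ν)                           ∎
  where open ≤-Reasoning

record Strippable (p : ℕ) (μ u : List ℕ) : Set where
  field
    parts-positive : All (0 <_) μ
    length-u       : length u ≡ sum μ
    blocks         : IncreasingBlocks μ u
    distinct       : Unique u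
    positive       : All (1 ≤_) u
    heads-occur    : ∀ {x} → InRange (length μ) x → x ∈ u
    heads-order    : SmallDecreasing (length μ) u
    no-middle      : All (λ x → x ≤ length μ ⊎ p < x) u
    few-blocks     : length μ ≤ p

open Strippable

module FirstBlock {p m μ x w} (S : Strippable p (suc m ∷ μ) (x ∷ w)) where
  K : ℕ
  K = suc (length μ)

  rest : List ℕ
  rest = drop m w

  rest-length : length rest ≡ sum μ
  rest-length = length-drop-+ m (sum μ) w (suc-injective (length-u S))

  rest-distinct : Unique rest
  rest-distinct = Unique.drop⁺ m (unique-tail (distinct S))

  rest-positive : All (1 ≤_) rest
  rest-positive = All.drop⁺ m (All.tail (positive S))

  rest-order : ∀ {K′} → K′ ≤ K → SmallDecreasing K′ rest
  rest-order K′≤K a≥1 a<b b≤K′ r = heads-order S a≥1 a<b (≤-trans b≤K′ K′≤K) (bthere (Before-drop m r))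

  large-tail : All (K <_) (take m w)
  large-tail = large-after-head (proj₁ (blocks S)) (distinct S) (All.head (positive S)) (heads-order S)

  small-in-rest : filter (_≤? K) w ≡ filter (_≤? K) rest
  small-in-rest = small-beyond-block (proj₁ (blocks S)) (distinct S) (All.head (positive S)) (heads-order S)

  -- The first entry is the largest head K: at least K values ≤ K occur, but
  -- only one per block if x > K; and if x < K then x would precede K.
  head≡K : x ≡ K
  head≡K with x ≟ K
  ... | yes x≡K = x≡K
  ... | no  x≢K with heads-occur S (s≤s z≤n , ≤-refl)
  ...   | here K≡x = ⊥-elim (x≢K (sym K≡x))
  ...   | there K∈w = ⊥-elim (heads-order S (All.head (positive S)) (≤∧≢⇒< x≤K x≢K) ≤-refl (bhere K∈w))
    where
    enough-small : K ≤ length (filter (_≤? K) (x ∷ w))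
    enough-small = subst (_≤ length (filter (_≤? K) (x ∷ w))) (range1-length K)
      (unique-⊆⇒length≤ (range1-unique K)
        (λ k∈ → let k-in = ∈-range1⁻ k∈ in ∈-filter⁺ (_≤? K) (heads-occur S k-in) (proj₂ k-in)))
    x≤K : x ≤ K
    x≤K with x ≤? K
    ... | yes x≤K = x≤K
    ... | no  x≰K = ⊥-elim (<-irrefl refl (≤-trans enough-small (begin
      length (filter (_≤? K) (x ∷ w)) ≡⟨ cong length (trans (filter-reject (_≤? K) x≰K) small-in-rest) ⟩
      length (filter (_≤? K) rest)    ≤⟨ count-small K μ rest (All.tail (parts-positive S)) rest-length (proj₂ (blocks S))
                                           rest-distinct rest-positive (rest-order ≤-refl) ⟩
      length μ                        ∎)))
      where open ≤-Reasoning

  tail-raised : All (p <_) (take m w)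
  tail-raised = All.zipWith (λ (K<y , y≤K⊎p<y) → [ (λ y≤K → ⊥-elim (<⇒≱ K<y y≤K)) , (λ p<y → p<y) ]′ y≤K⊎p<y)
    (large-tail , All.take⁺ m (All.tail (no-middle S)))

  rest-strippable : Strippable p μ rest
  rest-strippable = record
    { parts-positive = All.tail (parts-positive S)
    ; length-u       = rest-length
    ; blocks         = proj₂ (blocks S)
    ; distinct       = rest-distinct
    ; positive       = rest-positive
    ; heads-occur    = occur
    ; heads-order    = rest-order (n≤1+n _)
    ; no-middle      = All.tabulate (λ y∈ → middle y∈ (All.lookup (no-middle S) (there (∈-drop m y∈))))
    ; few-blocks     = ≤-trans (n≤1+n _) (few-blocks S)
    }
    where
    K∉w : K ∉ w
    K∉w K∈w with distinct S
    ... | x∉w ∷ _ = All.lookup x∉w K∈w head≡K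
    occur : ∀ {y} → InRange (length μ) y → y ∈ rest
    occur {y} (y≥1 , y≤) with heads-occur S (y≥1 , m≤n⇒m≤1+n y≤)
    ... | here y≡x = ⊥-elim (<-irrefl refl (subst (_≤ length μ) (trans y≡x head≡K) y≤))
    ... | there y∈w with ∈-++⁻ (take m w) (subst (y ∈_) (sym (take++drop≡id m w)) y∈w)
    ...   | inj₁ y∈t = ⊥-elim (<⇒≱ (All.lookup large-tail y∈t) (m≤n⇒m≤1+n y≤))
    ...   | inj₂ y∈r = y∈r
    middle : ∀ {y} → y ∈ rest → y ≤ K ⊎ p < y → y ≤ length μ ⊎ p < y
    middle _ (inj₂ p<y) = inj₂ p<y
    middle {y} y∈ (inj₁ y≤K) with y ≟ K
    ... | yes refl = ⊥-elim (K∉w (∈-drop m y∈))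
    ... | no  y≢K  = inj₁ (≤-pred (≤∧≢⇒< y≤K y≢K))

strip : ∀ {p} μ u → Strippable p μ u → ∃ (Stripped p μ u)
strip []          []      S = [] , nil
strip []          (_ ∷ _) S = ⊥-elim (1+n≢0 (length-u S))
strip (zero ∷ μ)  u       S = ⊥-elim (<-irrefl refl (All.head (parts-positive S)))
strip (suc m ∷ μ) []      S = ⊥-elim (0≢1+n (length-u S))
strip {p} (suc m ∷ μ) (x ∷ w) S with strip μ (drop m w) (FirstBlock.rest-strippable S)
... | v , s = c ++ v ,
  subst (λ k → Stripped p (suc k ∷ μ) (x ∷ w) (c ++ v)) length-c
    (subst₂ (λ h z → Stripped p (suc (length c) ∷ μ) (h ∷ z) (c ++ v))
      (sym head≡K) (trans (cong (_++ drop m w) raised) (take++drop≡id m w)) (block c≥1 s))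
  where
  open FirstBlock S
  c : List ℕ
  c = map (_∸ p) (take m w)
  raised : map (p +_) c ≡ take m w
  raised = trans (sym (map-∘ (take m w))) (map-id-local (All.map (λ p<y → m+[n∸m]≡n (<⇒≤ p<y)) tail-raised))
  c≥1 : All (1 ≤_) c
  c≥1 = All.map⁺ (All.map m<n⇒0<n∸m tail-raised)
  length-c : length c ≡ m
  length-c = trans (length-map (_∸ p) (take m w)) (length-take-+ m (sum μ) w (suc-injective (length-u S)))

Shifted-posOf<ᵇ : ∀ {p u v a b} → Shifted p u v → Unique u → Unique v → a ∈ v → b ∈ v → a ≢ b → 1 ≤ a → 1 ≤ b →
  (posOf u (p + a) <ᵇ posOf u (p + b)) ≡ (posOf v a <ᵇ posOf v b)
Shifted-posOf<ᵇ {p} sh u! v! a∈ b∈ a≢b a≥1 b≥1 = T-ext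
  (λ t → Before⇒posOf<ᵇ v! a≢b (shift-Before⁻ sh a≥1 b≥1 (posOf<ᵇ⇒Before u! (shift-∈⁺ sh a∈) (shift-∈⁺ sh b∈) pa≢pb t)))
  (λ t → Before⇒posOf<ᵇ u! pa≢pb (shift-Before⁺ sh (posOf<ᵇ⇒Before v! a∈ b∈ a≢b t)))
  where
  pa≢pb : p + _ ≢ p + _
  pa≢pb e = a≢b (+-cancelˡ-≡ p _ _ e)

descending⇒SmallDecreasing : ∀ {u} K → Unique u → (∀ j → 1 ≤ j → suc j ≤ K → posOf u (suc j) < posOf u j) →
  SmallDecreasing K u
descending⇒SmallDecreasing {u} K u! step {a} a≥1 a<b b≤K r = <-asym (chain a<b b≤K) (Before⇒posOf< u! (<⇒≢ a<b) r)
  where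
  chain : ∀ {b} → a < b → b ≤ K → posOf u b < posOf u a
  chain {suc b} (s≤s a≤b) b<K with a ≟ b
  ... | yes refl = step a a≥1 b<K
  ... | no  a≢b  = <-trans (step b (≤-trans a≥1 a≤b) b<K) (chain (≤∧≢⇒< a≤b a≢b) (≤-trans (n≤1+n b) b<K))

private
  shift-pair : ∀ p i → (p + suc (suc i) ≡ suc (suc (p + i))) × (p + suc i ≡ suc (p + i))
  shift-pair p i = trans (+-suc p (suc i)) (cong suc (+-suc p i)) , +-suc p i

Stripped-perm⁻ : ∀ {μ u v n′} → Stripped (length μ) μ u v → IsPerm (length μ + n′) u → IsPerm n′ v
Stripped-perm⁻ {μ} {n′ = n′} s (u! , lu , ru) =
  Stripped-unique⁻ s ≤-refl u! ,
  +-cancelˡ-≡ (length μ) _ _ (trans (sym (Stripped-length s)) lu) ,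
  All.tabulate (λ {y} y∈ → All.lookup (Stripped-positive s) y∈ ,
    +-cancelˡ-≤ (length μ) y n′ (proj₂ (All.lookup ru (shift-∈⁺ (Stripped⇒Shifted s ≤-refl) y∈))))

Stripped-perm⁺ : ∀ {μ u v n′} → Stripped (length μ) μ u v → IsPerm n′ v → IsPerm (length μ + n′) u
Stripped-perm⁺ {μ} {v = v} {n′} s (v! , lv , rv) =
  Stripped-unique⁺ s ≤-refl v! ,
  trans (Stripped-length s) (cong (length μ +_) lv) ,
  All.tabulate (λ x∈ → in-range (Stripped-∈ s x∈))
  where
  in-range : ∀ {x} → (1 ≤ x × x ≤ length μ) ⊎ ∃ (λ y → y ∈ v × x ≡ length μ + y) → InRange (length μ + n′) x
  in-range (inj₁ (x≥1 , x≤)) = x≥1 , ≤-trans x≤ (m≤m+n _ n′)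
  in-range (inj₂ (y , y∈ , refl)) = ≤-trans (proj₁ (All.lookup rv y∈)) (m≤n+m y _) , +-monoʳ-≤ (length μ) (proj₂ (All.lookup rv y∈))

Stripped-length-dropCols : ∀ {p μ u v} → Stripped p μ u v → All (0 <_) μ → length v ≡ sum (dropCols 1 μ)
Stripped-length-dropCols {μ = μ} s pos =
  +-cancelˡ-≡ (length μ) _ _ (trans (sym (Stripped-length s)) (trans (Stripped-length-sum s) (sym (length+sum-dropCols μ pos))))

Stripped-descents⁻ : ∀ {μ u v} → Stripped (length μ) μ u v → All (0 <_) μ →
  DescentsIn (isPartialSum μ) u → DescentsIn (isPartialSum (dropCols 1 μ)) v
Stripped-descents⁻ {μ} {u} {v} s pos des =
  blocks⇒descents (dropCols 1 μ) v (Stripped-length-dropCols s pos)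
    (proj₁ (IncreasingBlocks-positiveParts (map (_∸ 1) μ) v)
      (proj₁ (Stripped-blocks s ≤-refl) (descents⇒blocks μ u (Stripped-length-sum s) des)))

Stripped-descents⁺ : ∀ {μ u v} → Stripped (length μ) μ u v → All (0 <_) μ →
  DescentsIn (isPartialSum (dropCols 1 μ)) v → DescentsIn (isPartialSum μ) u
Stripped-descents⁺ {μ} {u} {v} s pos des =
  blocks⇒descents μ u (Stripped-length-sum s)
    (proj₂ (Stripped-blocks s ≤-refl)
      (proj₂ (IncreasingBlocks-positiveParts (map (_∸ 1) μ) v) (descents⇒blocks (dropCols 1 μ) v (Stripped-length-dropCols s pos) des)))

private
  <⇒<ᵇ≡true : ∀ {m n} → m < n → (m <ᵇ n) ≡ true
  <⇒<ᵇ≡true {m} {n} m<n with m <ᵇ n | <⇒<ᵇ m<n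
  ... | true | _ = refl

  ≮⇒<ᵇ≡false : ∀ {m n} → ¬ m < n → (m <ᵇ n) ≡ false
  ≮⇒<ᵇ≡false {m} {n} m≮n with m <ᵇ n in eq
  ... | false = refl
  ... | true  = ⊥-elim (m≮n (<ᵇ⇒< m n (subst T (sym eq) tt)))

  Stripped-posOf-first : ∀ {p μ u v} → Stripped p μ u v → 1 ≤ length μ → posOf u (length μ) ≡ 1
  Stripped-posOf-first {p} (block {μ} {u} {c = c} _ _) _ = posOf-head (suc (length μ)) (map (p +_) c ++ u)

-- No left descent at |μ|: the head |μ| is the first entry of u, so |μ|+1
-- (the raised value 1 of v) cannot precede it.
Stripped-no-descent-at-heads : ∀ {μ u v n′} → Stripped (length μ) μ u v → IsPerm n′ v → 1 ≤ length μ → 0 < n′ →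
  (posOf u (suc (length μ)) <ᵇ posOf u (length μ)) ≡ false
Stripped-no-descent-at-heads {μ} {u} s v-perm μ≥1 n′>0 = ≮⇒<ᵇ≡false not-before
  where
  not-before : ¬ posOf u (suc (length μ)) < posOf u (length μ)
  not-before lt with posOf-∈ (shift-∈⁺ (Stripped⇒Shifted s ≤-refl) (perm-surjective v-perm (≤-refl , n′>0)))
  ... | k , eq = <⇒≱ lt (subst₂ _≤_ (sym (Stripped-posOf-first s μ≥1)) (sym (trans (cong (posOf u) (+-comm 1 (length μ))) eq)) (s≤s z≤n))

Stripped-left-beyond : ∀ {μ u v n′} → Stripped (length μ) μ u v → Unique u → IsPerm n′ v → ∀ i → suc i < n′ →
  (posOf u (suc (suc (length μ + i))) <ᵇ posOf u (suc (length μ + i))) ≡ (posOf v (suc (suc i)) <ᵇ posOf v (suc i))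
Stripped-left-beyond {μ} {u} {v} {n′} s u! v-perm i i+1<n′ = begin
  (posOf u (suc (suc (p + i))) <ᵇ posOf u (suc (p + i)))
    ≡⟨ sym (cong₂ (λ x y → posOf u x <ᵇ posOf u y) (proj₁ (shift-pair p i)) (proj₂ (shift-pair p i))) ⟩
  (posOf u (p + suc (suc i)) <ᵇ posOf u (p + suc i))
    ≡⟨ Shifted-posOf<ᵇ (Stripped⇒Shifted s ≤-refl) u! (proj₁ v-perm) (occurs i+1<n′) (occurs (<⇒≤ i+1<n′)) 1+n≢n (s≤s z≤n) (s≤s z≤n) ⟩
  (posOf v (suc (suc i)) <ᵇ posOf v (suc i)) ∎
  where
  open ≡-Reasoning
  p : ℕ
  p = length μ
  occurs : ∀ {x} → suc x ≤ n′ → suc x ∈ v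
  occurs lt = perm-surjective v-perm (s≤s z≤n , lt)

Stripped-left⁻ : ∀ {μ u v n′ ν} → Stripped (length μ) μ u v → Unique u → IsPerm n′ v →
  LeftDescentsOff (length μ + n′) (isPartialSum (length μ ∷ ν)) u → LeftDescentsOff n′ (isPartialSum ν) v
Stripped-left⁻ {μ} {u} {v} {n′} {ν} s u! v-perm left i i+1<n′ = begin
  (posOf v (suc (suc i)) <ᵇ posOf v (suc i))              ≡⟨ sym (Stripped-left-beyond s u! v-perm i i+1<n′) ⟩
  (posOf u (suc (suc (p + i))) <ᵇ posOf u (suc (p + i)))  ≡⟨ left (p + i) (subst (_< p + n′) (proj₂ (shift-pair p i)) (+-monoʳ-< p i+1<n′)) ⟩
  not (isPartialSum (p ∷ ν) (suc (p + i)))                ≡⟨ cong not (trans (cong (isPartialSum (p ∷ ν)) (sym (proj₂ (shift-pair p i)))) (isPartialSum-shift p ν i)) ⟩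
  not (isPartialSum ν (suc i))                            ∎
  where
  open ≡-Reasoning
  p : ℕ
  p = length μ

-- Conversely: the heads give the descents 1, …, |μ|-1, the block start |μ|
-- stands before |μ|+1, and beyond the first column u behaves like v.
Stripped-left⁺ : ∀ {μ u v n′ ν} → Stripped (length μ) μ u v → Unique u → IsPerm n′ v →
  (0 < n′ → isPartialSum (length μ ∷ ν) (length μ) ≡ true) →
  LeftDescentsOff n′ (isPartialSum ν) v → LeftDescentsOff (length μ + n′) (isPartialSum (length μ ∷ ν)) u
Stripped-left⁺ {μ} {u} {v} {n′} {ν} s u! v-perm boundary left i i+1<n with <-cmp (suc i) (length μ)
... | tri< i+1<p _ _ = begin
  (posOf u (suc (suc i)) <ᵇ posOf u (suc i))  ≡⟨ <⇒<ᵇ≡true (Before⇒posOf< u! 1+n≢n (Stripped-heads-Before s (suc i) (s≤s z≤n) i+1<p)) ⟩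
  true                                         ≡⟨ cong not (sym (isPartialSum-below (length μ) ν (suc i) i+1<p)) ⟩
  not (isPartialSum (length μ ∷ ν) (suc i))    ∎
  where open ≡-Reasoning
... | tri≈ _ i+1≡p _ = begin
  (posOf u (suc (suc i)) <ᵇ posOf u (suc i))  ≡⟨ cong (λ j → posOf u (suc j) <ᵇ posOf u j) i+1≡p ⟩
  (posOf u (suc p) <ᵇ posOf u p)              ≡⟨ Stripped-no-descent-at-heads s v-perm (subst (1 ≤_) i+1≡p (s≤s z≤n)) n′>0 ⟩
  false                                        ≡⟨ cong not (sym (trans (cong (isPartialSum (p ∷ ν)) i+1≡p) (boundary n′>0))) ⟩
  not (isPartialSum (p ∷ ν) (suc i))           ∎
  where
  open ≡-Reasoning
  p : ℕ
  p = length μ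
  n′>0 : 0 < n′
  n′>0 = +-cancelˡ-< p 0 n′ (subst₂ _<_ (trans i+1≡p (sym (+-identityʳ p))) refl i+1<n)
... | tri> _ _ p<i+1 with m≤n⇒∃[o]m+o≡n (≤-pred p<i+1)
...   | k , refl = begin
  (posOf u (suc (suc (p + k))) <ᵇ posOf u (suc (p + k)))  ≡⟨ Stripped-left-beyond s u! v-perm k k+1<n′ ⟩
  (posOf v (suc (suc k)) <ᵇ posOf v (suc k))              ≡⟨ left k k+1<n′ ⟩
  not (isPartialSum ν (suc k))                            ≡⟨ cong not (sym (trans (cong (isPartialSum (p ∷ ν)) (sym (proj₂ (shift-pair p k)))) (isPartialSum-shift p ν k))) ⟩
  not (isPartialSum (p ∷ ν) (suc (p + k)))                ∎
  where
  open ≡-Reasoning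
  p : ℕ
  p = length μ
  k+1<n′ : suc k < n′
  k+1<n′ = +-cancelˡ-< p (suc k) n′ (subst (_< p + n′) (sym (proj₂ (shift-pair p k))) i+1<n)

module HeadDeletion (μ ν : List ℕ) (n′ : ℕ) (parts-positive : All (0 <_) μ) (size : sum μ ≡ length μ + n′)
                    (boundary : 0 < n′ → isPartialSum (length μ ∷ ν) (length μ) ≡ true) where

  p : ℕ
  p = length μ

  Source : List ℕ → Set
  Source u = IsPerm (p + n′) u × LeftDescentsOff (p + n′) (isPartialSum (p ∷ ν)) u × DescentsIn (isPartialSum μ) u

  Target : List ℕ → Set
  Target v = IsPerm n′ v × LeftDescentsOff n′ (isPartialSum ν) v × DescentsIn (isPartialSum (dropCols 1 μ)) v

  -- A source permutation lists the heads p, p-1, …, 1 in this order (these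
  -- are exactly its left descents below p), so it can be stripped.
  Source⇒Strippable : ∀ {u} → Source u → Strippable p μ u
  Source⇒Strippable {u} ((u! , lu , ru) , left , right) = record
    { parts-positive = parts-positive
    ; length-u       = u-length
    ; blocks         = descents⇒blocks μ u u-length right
    ; distinct       = u!
    ; positive       = All.map proj₁ ru
    ; heads-occur    = λ (x≥1 , x≤p) → perm-surjective (u! , lu , ru) (x≥1 , ≤-trans x≤p (m≤m+n p n′))
    ; heads-order    = descending⇒SmallDecreasing p u! head-descent
    ; no-middle      = All.tabulate (λ {x} _ → ≤-<-connex x p)
    ; few-blocks     = ≤-refl
    }
    where
    u-length : length u ≡ sum μ
    u-length = trans lu (sym size)
    head-descent : ∀ j → 1 ≤ j → suc j ≤ p → posOf u (suc j) < posOf u j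
    head-descent (suc i) _ i+2≤p = <ᵇ⇒< _ _ (subst T (sym (trans (left i (<-≤-trans i+2≤p (m≤m+n p n′)))
                                        (cong not (isPartialSum-below p ν (suc i) i+2≤p)))) tt)

  forward : ∀ {u} → Source u → Target (deleteHeads p μ u) × insertHeads p μ (deleteHeads p μ u) ≡ u
  forward {u} src@(perm , left , right) with strip μ u (Source⇒Strippable src)
  ... | v , s = subst Target (Stripped⇒deleteHeads s) (v-perm , Stripped-left⁻ {ν = ν} s (proj₁ perm) v-perm left , Stripped-descents⁻ s parts-positive right) ,
                trans (cong (insertHeads p μ) (sym (Stripped⇒deleteHeads s))) (sym (Stripped⇒insertHeads s))
    where
    v-perm : IsPerm n′ v
    v-perm = Stripped-perm⁻ s perm

  backward : ∀ {v} → Target v → Source (insertHeads p μ v) × deleteHeads p μ (insertHeads p μ v) ≡ v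
  backward {v} (perm , left , right) =
    (u-perm , Stripped-left⁺ {ν = ν} s (proj₁ u-perm) perm boundary left , Stripped-descents⁺ s parts-positive right) ,
    sym (Stripped⇒deleteHeads s)
    where
    length-v : length v ≡ sum (map (_∸ 1) μ)
    length-v = +-cancelˡ-≡ p _ _ (trans (cong (p +_) (proj₁ (proj₂ perm))) (trans (sym size) (sym (length+sum-pred μ parts-positive))))
    s : Stripped p μ (insertHeads p μ v) v
    s = insertHeads-Stripped p μ parts-positive v (All.map proj₁ (proj₂ (proj₂ perm))) length-v
    u-perm : IsPerm (p + n′) (insertHeads p μ v)
    u-perm = Stripped-perm⁺ s perm

one-column : ∀ n lam mu → IsPartition n lam → IsPartition n mu → colLen lam 1 ≡ colLen mu 1 →
  A n lam mu ≡ A (sum (dropCols 1 lam)) (dropCols 1 lam) (dropCols 1 mu)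
one-column n []             []            (_ , _ , refl)    _                 _  = refl
one-column n []             (suc _ ∷ _)   _                 _                 ()
one-column n []             (zero ∷ _)    _                 (_ , () ∷ _ , _)  _
one-column n (suc _ ∷ _)    []            _                 _                 ()
one-column n (zero ∷ _)     _             (_ , () ∷ _ , _)  _                 _
one-column n (suc _ ∷ _)    (zero ∷ _)    _                 (_ , () ∷ _ , _)  _
one-column n lam@(suc a ∷ lam₀) mu@(suc _ ∷ _) (dec , posL , sumL) (_ , posM , sumM) same-column = begin
  A n lam mu                                ≡⟨ cong (λ m → A m lam mu) n≡p+n′ ⟩
  A (p + n′) lam mu                         ≡⟨ A-as-length (p + n′) lam mu ⟩
  length (countedList (p + n′) lam mu)      ≡⟨ length-≡-by-inverses (countedList-unique (p + n′) lam mu) (countedList-unique n′ lam′ mu′)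
                                                 (deleteHeads p mu) (insertHeads p mu)
                                                 (λ u∈ → ∈-countedList⁺ n′ lam′ mu′ (proj₁ (forward (source u∈))))
                                                 (λ v∈ → source⁻ (proj₁ (backward (∈-countedList⁻ n′ lam′ mu′ v∈))))
                                                 (λ u∈ → proj₂ (forward (source u∈))) (λ v∈ → proj₂ (backward (∈-countedList⁻ n′ lam′ mu′ v∈))) ⟩
  length (countedList n′ lam′ mu′)          ≡⟨ sym (A-as-length n′ lam′ mu′) ⟩
  A n′ lam′ mu′                             ∎
  where
  open ≡-Reasoning
  lam′ mu′ : List ℕ
  lam′ = dropCols 1 lam
  mu′ = dropCols 1 mu
  p n′ : ℕ
  p = length mu
  n′ = sum lam′
  same-height : length lam ≡ p
  same-height = trans (sym (colLen-one lam posL)) (trans same-column (colLen-one mu posM))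
  n≡p+n′ : n ≡ p + n′
  n≡p+n′ = trans (sym sumL) (trans (sym (length+sum-dropCols lam posL)) (cong (_+ n′) same-height))
  dual-lam : dual lam ≡ p ∷ dual lam′
  dual-lam = trans (dual-cons a lam₀ dec posL) (cong (_∷ dual lam′) same-height)
  open HeadDeletion mu (dual lam′) n′ posM (trans sumM n≡p+n′) (λ n′>0 → isPartialSum-dual p lam′ n′>0 (All-positiveParts (map (_∸ 1) lam)))
    using (Source; forward; backward)
  source : ∀ {u} → u ∈ countedList (p + n′) lam mu → Source u
  source {u} u∈ with ∈-countedList⁻ (p + n′) lam mu u∈
  ... | perm , left , right = perm , subst (λ d → LeftDescentsOff (p + n′) (isPartialSum d) u) dual-lam left , right
  source⁻ : ∀ {u} → Source u → u ∈ countedList (p + n′) lam mu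
  source⁻ {u} (perm , left , right) =
    ∈-countedList⁺ (p + n′) lam mu (perm , subst (λ d → LeftDescentsOff (p + n′) (isPartialSum d) u) (sym dual-lam) left , right)

dropCols-same-size : ∀ {n} lam mu → IsPartition n lam → IsPartition n mu → colLen lam 1 ≡ colLen mu 1 →
  sum (dropCols 1 mu) ≡ sum (dropCols 1 lam)
dropCols-same-size lam mu (_ , posL , sumL) (_ , posM , sumM) same-column = +-cancelˡ-≡ (length mu) _ _ (begin
  length mu + sum (dropCols 1 mu)   ≡⟨ length+sum-dropCols mu posM ⟩
  sum mu                            ≡⟨ trans sumM (sym sumL) ⟩
  sum lam                           ≡⟨ sym (length+sum-dropCols lam posL) ⟩
  length lam + sum (dropCols 1 lam) ≡⟨ cong (_+ sum (dropCols 1 lam)) same-height ⟩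
  length mu + sum (dropCols 1 lam)  ∎)
  where
  open ≡-Reasoning
  same-height : length lam ≡ length mu
  same-height = trans (sym (colLen-one lam posL)) (trans same-column (colLen-one mu posM))

drop-columns : ∀ ℓ n lam mu → IsPartition n lam → IsPartition n mu → (∀ s → 1 ≤ s → s ≤ ℓ → colLen lam s ≡ colLen mu s) →
  A n lam mu ≡ A (sum (dropCols ℓ lam)) (dropCols ℓ lam) (dropCols ℓ mu)
drop-columns zero n lam mu (_ , posL , sumL) (_ , posM , _) _
  rewrite dropCols-zero lam posL | dropCols-zero mu posM | sumL = refl
drop-columns (suc ℓ) n lam mu PL PM same-columns = begin
  A n lam mu                                                ≡⟨ one-column n lam mu PL PM first ⟩
  A (sum lam′) lam′ mu′                                     ≡⟨ drop-columns ℓ (sum lam′) lam′ mu′ PL′ PM′ later ⟩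
  A (sum (dropCols ℓ lam′)) (dropCols ℓ lam′) (dropCols ℓ mu′) ≡⟨ sym (cong₂ (λ l m → A (sum l) l m) (dropCols-suc ℓ lam) (dropCols-suc ℓ mu)) ⟩
  A (sum (dropCols (suc ℓ) lam)) (dropCols (suc ℓ) lam) (dropCols (suc ℓ) mu) ∎
  where
  open ≡-Reasoning
  lam′ mu′ : List ℕ
  lam′ = dropCols 1 lam
  mu′ = dropCols 1 mu
  first : colLen lam 1 ≡ colLen mu 1
  first = same-columns 1 ≤-refl (s≤s z≤n)
  PL′ : IsPartition (sum lam′) lam′
  PL′ = dropCols-partition _ lam PL
  PM′ : IsPartition (sum lam′) mu′
  PM′ = let (dec , pos , _) = dropCols-partition _ mu PM in dec , pos , dropCols-same-size lam mu PL PM first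
  later : ∀ s → 1 ≤ s → s ≤ ℓ → colLen lam′ s ≡ colLen mu′ s
  later s s≥1 s≤ℓ = trans (colLen-dropCols lam s s≥1) (trans (same-columns (suc s) (s≤s z≤n) (s≤s s≤ℓ)) (sym (colLen-dropCols mu s s≥1)))

corollary4p14 : (n : ℕ) (lam mu : List ℕ) → IsPartition n lam → IsPartition n mu →
    (ℓ : ℕ) → 1 ≤ ℓ → ((s : ℕ) → 1 ≤ s → s ≤ ℓ → colLen lam s ≡ colLen mu s) →
    A n lam mu ≡ A (sum (dropCols ℓ lam)) (dropCols ℓ lam) (dropCols ℓ mu)
corollary4p14 n lam mu PL PM ℓ _ same-columns = drop-columns ℓ n lam mu PL PM same-columns
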